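{- If $\vdash_{ipa} C$, then $(C)^\circ$ is derivable in $FO\lambda^{\Delta\mathbb{N}}$ using the definition $\mathcal{D}(eq)$ consisting of the single clause $I=I\triangleq\top$.
   Context: $FO\lambda^{\Delta\mathbb{N}}$ is the following intuitionistic sequent calculus. Terms are simply typed $\lambda$-terms (up to $\alpha\beta\eta$-conversion) over a signature of typed constants; $o$ is the type of formulas, and quantifiers range only over types not containing $o$. Formulas are built from atomic formulas with $\bot,\top,\land,\lor,\supset,\forall,\exists$. There is a type $nt$ with constants $z:nt$, $s:nt\to nt$ and a predicate $nat: nt\to o$; here also $=\,: nt\to nt\to o$. Sequents are $\Gamma\longrightarrow B$, $\Gamma$ a finite multiset. Rules: $\bot,\Gamma\longrightarrow B$ and $\Gamma\longrightarrow\top$ are axioms; the usual intuitionistic left and right rules for $\land,\lor,\supset,\forall,\exists$ (with the usual eigenvariable conditions); initial sequents $A,\Gamma\longrightarrow A$ for atomic $A$; left contraction; cut. For $nat$: $\Gamma\longrightarrow nat\,z$; from $\Gamma\longrightarrow nat\,I$ infer $\Gamma\longrightarrow nat\,(s\,I)$; induction: for $B:nt\to o$ and eigenvariable $j$ not free in $B$, from $\longrightarrow B\,z$, $B\,j\longrightarrow B\,(s\,j)$, $B\,I,\Gamma\longrightarrow C$ infer $nat\,I,\Gamma\longrightarrow C$. Relative to a definition (set of clauses $\forall\bar x[p\,\bar t\triangleq B]$, free variables of $B$ occurring in $\bar t$): right rule: from $\Gamma\longrightarrow B\theta$ infer $\Gamma\longrightarrow p\,\bar u$ when $p\,\bar u=(p\,\bar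 t)\theta$; left rule: infer $p\,\bar u,\Gamma\longrightarrow C$ from the premises $B\theta,\Gamma\theta\longrightarrow C\theta$ for every clause (renamed apart) and every $\theta$ in a complete set of unifiers of $p\,\bar u$ and $p\,\bar t$. A formula is derivable using a definition if $\longrightarrow F$ has a derivation. IPA (intuitionistic Peano arithmetic, in this restricted signature) is the first-order intuitionistic theory with equality whose terms are built from variables, $z$ and $s$, with connectives $\bot,\top,\land,\lor,\supset,\forall,\exists$, with axioms: all axioms of first-order intuitionistic logic; reflexivity, symmetry, transitivity and substitution axioms for equality; $\forall x\forall y(s\,x=s\,y\supset x=y)$ and $\forall x(z=s\,x\supset\bot)$; and all induction axioms $\varphi(z)\land\forall j(\varphi(j)\supset\varphi(s\,j))\supset\forall x\varphi(x)$ for formulas $\varphi(x)$ with at most $x$ free. Inference rules are modus ponens and universal generalization (from $B$ infer $\forall x B$); $\vdash_{ipa}C$ means $C$ is the last formula of a list each of whose members is an axiom or follows from earlier members by these rules. The translation $(\cdot)^\circ$ maps IPA formulas to $FO\lambda^{\Delta\mathbb{N}}$ formulas by sending the single sort to $nt$, equality to $=$, commuting with $\bot,\top,\land,\lor,\supset$, and setting $(\forall x.B)^\circ=\forall x(nat\,x\supset B^\circ)$ and $(\exists x.B)^\circ=\exists x(nat\,x\land B^\circ)$.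
   Formalization: The implication covers only closed IPA formulas C: if C is a sentence with $\vdash_{ipa} C$, then $(C)^\circ$ is derivable using $\mathcal{D}(eq)$. The statement above fails without it. -}

module Defs where

open import Data.Nat using (ℕ; _≡ᵇ_)
open import Data.Bool using (if_then_else_)
open import Data.List using (List; []; _∷_; map)
open import Data.Product using (Σ; _×_; _,_)
open import Data.Sum using (_⊎_)
open import Relation.Binary.PropositionalEquality using (_≡_; _≢_)
open import Relation.Nullary using (¬_)
open import Data.List.Membership.Propositional using (_∈_)
open import Data.List.Relation.Binary.Permutation.Propositional using (_↭_)
open import Data.List.Relation.Binary.Pointwise using (Pointwise)

data ITm : Set where
  ivar : ℕ → ITm
  iz   : ITm
  is   : ITm → ITm

infix  6 _≐_
infixr 5 _∧ⁱ_
infixr 4 _∨ⁱ_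
infixr 3 _⊃ⁱ_

data IFm : Set where
  _≐_  : ITm → ITm → IFm
  ⊥ⁱ ⊤ⁱ : IFm
  _∧ⁱ_ _∨ⁱ_ _⊃ⁱ_ : IFm → IFm → IFm
  ∀ⁱ ∃ⁱ : ℕ → IFm → IFm

data _∈ₜ_ (x : ℕ) : ITm → Set where
  here : x ∈ₜ ivar x
  ins  : ∀ {u} → x ∈ₜ u → x ∈ₜ is u

data _∈ᶠᵛ_ (x : ℕ) : IFm → Set where
  eqˡ : ∀ {a b} → x ∈ₜ a → x ∈ᶠᵛ (a ≐ b)
  eqʳ : ∀ {a b} → x ∈ₜ b → x ∈ᶠᵛ (a ≐ b)
  ∧ˡ  : ∀ {A B} → x ∈ᶠᵛ A → x ∈ᶠᵛ (A ∧ⁱ B)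
  ∧ʳ  : ∀ {A B} → x ∈ᶠᵛ B → x ∈ᶠᵛ (A ∧ⁱ B)
  ∨ˡ  : ∀ {A B} → x ∈ᶠᵛ A → x ∈ᶠᵛ (A ∨ⁱ B)
  ∨ʳ  : ∀ {A B} → x ∈ᶠᵛ B → x ∈ᶠᵛ (A ∨ⁱ B)
  ⊃ˡ  : ∀ {A B} → x ∈ᶠᵛ A → x ∈ᶠᵛ (A ⊃ⁱ B)
  ⊃ʳ  : ∀ {A B} → x ∈ᶠᵛ B → x ∈ᶠᵛ (A ⊃ⁱ B)
  ∀∈  : ∀ {y A} → x ≢ y → x ∈ᶠᵛ A → x ∈ᶠᵛ ∀ⁱ y A
  ∃∈  : ∀ {y A} → x ≢ y → x ∈ᶠᵛ A → x ∈ᶠᵛ ∃ⁱ y A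

Closed : IFm → Set
Closed A = ∀ x → ¬ (x ∈ᶠᵛ A)

-- (naive) substitution of t for the free occurrences of x
substT : ITm → ℕ → ITm → ITm
substT t x (ivar y) = if x ≡ᵇ y then t else ivar y
substT t x iz       = iz
substT t x (is u)   = is (substT t x u)

substF : ITm → ℕ → IFm → IFm
substF t x (a ≐ b)  = substT t x a ≐ substT t x b
substF t x ⊥ⁱ       = ⊥ⁱ
substF t x ⊤ⁱ       = ⊤ⁱ
substF t x (A ∧ⁱ B) = substF t x A ∧ⁱ substF t x B
substF t x (A ∨ⁱ B) = substF t x A ∨ⁱ substF t x B
substF t x (A ⊃ⁱ B) = substF t x A ⊃ⁱ substF t x B
substF t x (∀ⁱ y A) = if x ≡ᵇ y then ∀ⁱ y A else ∀ⁱ y (substF t x A)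
substF t x (∃ⁱ y A) = if x ≡ᵇ y then ∃ⁱ y A else ∃ⁱ y (substF t x A)

data FreeFor (t : ITm) (x : ℕ) : IFm → Set where
  ff≐ : ∀ {a b} → FreeFor t x (a ≐ b)
  ff⊥ : FreeFor t x ⊥ⁱ
  ff⊤ : FreeFor t x ⊤ⁱ
  ff∧ : ∀ {A B} → FreeFor t x A → FreeFor t x B → FreeFor t x (A ∧ⁱ B)
  ff∨ : ∀ {A B} → FreeFor t x A → FreeFor t x B → FreeFor t x (A ∨ⁱ B)
  ff⊃ : ∀ {A B} → FreeFor t x A → FreeFor t x B → FreeFor t x (A ⊃ⁱ B)
  ff∀₀ : ∀ {y A} → ¬ (x ∈ᶠᵛ ∀ⁱ y A) → FreeFor t x (∀ⁱ y A)
  ff∀  : ∀ {y A} → ¬ (y ∈ₜ t) → FreeFor t x A → FreeFor t x (∀ⁱ y A)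
  ff∃₀ : ∀ {y A} → ¬ (x ∈ᶠᵛ ∃ⁱ y A) → FreeFor t x (∃ⁱ y A)
  ff∃  : ∀ {y A} → ¬ (y ∈ₜ t) → FreeFor t x A → FreeFor t x (∃ⁱ y A)

v : ℕ → ITm
v = ivar

data IAx : IFm → Set where
  axK   : ∀ {A B} → IAx (A ⊃ⁱ B ⊃ⁱ A)
  axS   : ∀ {A B C} → IAx ((A ⊃ⁱ B ⊃ⁱ C) ⊃ⁱ (A ⊃ⁱ B) ⊃ⁱ A ⊃ⁱ C)
  ax∧E₁ : ∀ {A B} → IAx (A ∧ⁱ B ⊃ⁱ A)
  ax∧E₂ : ∀ {A B} → IAx (A ∧ⁱ B ⊃ⁱ B)
  ax∧I  : ∀ {A B} → IAx (A ⊃ⁱ B ⊃ⁱ A ∧ⁱ B)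
  ax∨I₁ : ∀ {A B} → IAx (A ⊃ⁱ A ∨ⁱ B)
  ax∨I₂ : ∀ {A B} → IAx (B ⊃ⁱ A ∨ⁱ B)
  ax∨E  : ∀ {A B C} → IAx ((A ⊃ⁱ C) ⊃ⁱ (B ⊃ⁱ C) ⊃ⁱ A ∨ⁱ B ⊃ⁱ C)
  ax⊥E  : ∀ {A} → IAx (⊥ⁱ ⊃ⁱ A)
  ax⊤I  : IAx ⊤ⁱ
  ax∀E  : ∀ {t x A} → FreeFor t x A → IAx (∀ⁱ x A ⊃ⁱ substF t x A)
  ax∃I  : ∀ {t x A} → FreeFor t x A → IAx (substF t x A ⊃ⁱ ∃ⁱ x A)
  ax∀I  : ∀ {x A B} → ¬ (x ∈ᶠᵛ B) → IAx (∀ⁱ x (B ⊃ⁱ A) ⊃ⁱ B ⊃ⁱ ∀ⁱ x A)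
  ax∃E  : ∀ {x A B} → ¬ (x ∈ᶠᵛ B) → IAx (∀ⁱ x (A ⊃ⁱ B) ⊃ⁱ ∃ⁱ x A ⊃ⁱ B)
  axRefl  : IAx (∀ⁱ 0 (v 0 ≐ v 0))
  axSym   : IAx (∀ⁱ 0 (∀ⁱ 1 (v 0 ≐ v 1 ⊃ⁱ v 1 ≐ v 0)))
  axTrans : IAx (∀ⁱ 0 (∀ⁱ 1 (∀ⁱ 2 (v 0 ≐ v 1 ⊃ⁱ v 1 ≐ v 2 ⊃ⁱ v 0 ≐ v 2))))
  axSubS  : IAx (∀ⁱ 0 (∀ⁱ 1 (v 0 ≐ v 1 ⊃ⁱ is (v 0) ≐ is (v 1))))
  axSubEq : IAx (∀ⁱ 0 (∀ⁱ 1 (∀ⁱ 2 (∀ⁱ 3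
              (v 0 ≐ v 1 ⊃ⁱ v 2 ≐ v 3 ⊃ⁱ v 0 ≐ v 2 ⊃ⁱ v 1 ≐ v 3)))))
  axInj   : IAx (∀ⁱ 0 (∀ⁱ 1 (is (v 0) ≐ is (v 1) ⊃ⁱ v 0 ≐ v 1)))
  axZS    : IAx (∀ⁱ 0 (iz ≐ is (v 0) ⊃ⁱ ⊥ⁱ))
  -- induction, for φ with at most x free (bound variable j chosen to be x)
  axInd   : ∀ {φ x} → (∀ y → y ∈ᶠᵛ φ → y ≡ x) →
            IAx (substF iz x φ ∧ⁱ ∀ⁱ x (φ ⊃ⁱ substF (is (v x)) x φ) ⊃ⁱ ∀ⁱ x φ)

Follows : List IFm → IFm → Set
Follows Φ C = IAx C
            ⊎ (Σ IFm λ B → B ∈ Φ × (B ⊃ⁱ C) ∈ Φ)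
            ⊎ (Σ ℕ λ x → Σ IFm λ B → C ≡ ∀ⁱ x B × B ∈ Φ)

-- a Hilbert derivation, stored in reverse (last formula first)
data HList : List IFm → Set where
  nil  : HList []
  snoc : ∀ {Φ C} → HList Φ → Follows Φ C → HList (C ∷ Φ)

⊢ipa_ : IFm → Set
⊢ipa C = Σ (List IFm) λ Φ → HList (C ∷ Φ)

-- types not containing o; nt is built in, further base types from the signature
infixr 7 _⇒_

data Ty (B : Set) : Set where
  nt   : Ty B
  base : B → Ty B
  _⇒_  : Ty B → Ty B → Ty B

record Signature : Set₁ where
  field
    Base    : Set
    Const   : Set
    constTy : Const → Ty Base
    Pred    : Set
    predTy  : Pred → List (Ty Base) -- argument types (result type o)

module Sys (Sg : Signature) where
  open Signature Sg

  Type = Ty Base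
  Ctx  = List Type

  data _∋_ : Ctx → Type → Set where
    here  : ∀ {Δ τ} → (τ ∷ Δ) ∋ τ
    there : ∀ {Δ σ τ} → Δ ∋ τ → (σ ∷ Δ) ∋ τ

  data Tm (Δ : Ctx) : Type → Set where
    var : ∀ {τ} → Δ ∋ τ → Tm Δ τ
    con : (c : Const) → Tm Δ (constTy c)
    zc  : Tm Δ nt
    sc  : Tm Δ (nt ⇒ nt)
    lam : ∀ {σ τ} → Tm (σ ∷ Δ) τ → Tm Δ (σ ⇒ τ)
    app : ∀ {σ τ} → Tm Δ (σ ⇒ τ) → Tm Δ σ → Tm Δ τ

  Ren : Ctx → Ctx → Set
  Ren Δ Δ' = ∀ {τ} → Δ ∋ τ → Δ' ∋ τ

  ext : ∀ {Δ Δ' σ} → Ren Δ Δ' → Ren (σ ∷ Δ) (σ ∷ Δ')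
  ext r here      = here
  ext r (there x) = there (r x)

  ren : ∀ {Δ Δ' τ} → Ren Δ Δ' → Tm Δ τ → Tm Δ' τ
  ren r (var x)   = var (r x)
  ren r (con c)   = con c
  ren r zc        = zc
  ren r sc        = sc
  ren r (lam t)   = lam (ren (ext r) t)
  ren r (app t u) = app (ren r t) (ren r u)

  Sub : Ctx → Ctx → Set
  Sub Δ Δ' = ∀ {τ} → Δ ∋ τ → Tm Δ' τ

  exts : ∀ {Δ Δ' σ} → Sub Δ Δ' → Sub (σ ∷ Δ) (σ ∷ Δ')
  exts s here      = var here
  exts s (there x) = ren there (s x)

  sub : ∀ {Δ Δ' τ} → Sub Δ Δ' → Tm Δ τ → Tm Δ' τ
  sub s (var x)   = s x
  sub s (con c)   = con c
  sub s zc        = zc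
  sub s sc        = sc
  sub s (lam t)   = lam (sub (exts s) t)
  sub s (app t u) = app (sub s t) (sub s u)

  σ₀ : ∀ {Δ σ} → Tm Δ σ → Sub (σ ∷ Δ) Δ
  σ₀ u here      = u
  σ₀ u (there x) = var x

  infix 4 _≈_
  data _≈_ {Δ : Ctx} : ∀ {τ} → Tm Δ τ → Tm Δ τ → Set where
    β    : ∀ {σ τ} {t : Tm (σ ∷ Δ) τ} {u : Tm Δ σ} → app (lam t) u ≈ sub (σ₀ u) t
    η    : ∀ {σ τ} {t : Tm Δ (σ ⇒ τ)} → lam (app (ren there t) (var here)) ≈ t
    ≈refl  : ∀ {τ} {t : Tm Δ τ} → t ≈ t
    ≈sym   : ∀ {τ} {t u : Tm Δ τ} → t ≈ u → u ≈ t
    ≈trans : ∀ {τ} {t u w : Tm Δ τ} → t ≈ u → u ≈ w → t ≈ w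
    ≈lam   : ∀ {σ τ} {t t' : Tm (σ ∷ Δ) τ} → t ≈ t' → lam t ≈ lam t'
    ≈app   : ∀ {σ τ} {t t' : Tm Δ (σ ⇒ τ)} {u u' : Tm Δ σ} →
             t ≈ t' → u ≈ u' → app t u ≈ app t' u'

  data Args (Δ : Ctx) : List Type → Set where
    []  : Args Δ []
    _∷_ : ∀ {τ τs} → Tm Δ τ → Args Δ τs → Args Δ (τ ∷ τs)

  renA : ∀ {Δ Δ' τs} → Ren Δ Δ' → Args Δ τs → Args Δ' τs
  renA r []       = []
  renA r (t ∷ ts) = ren r t ∷ renA r ts

  subA : ∀ {Δ Δ' τs} → Sub Δ Δ' → Args Δ τs → Args Δ' τs
  subA s []       = []
  subA s (t ∷ ts) = sub s t ∷ subA s ts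

  data _≈A_ {Δ : Ctx} : ∀ {τs} → Args Δ τs → Args Δ τs → Set where
    []  : [] ≈A []
    _∷_ : ∀ {τ τs} {t t' : Tm Δ τ} {ts ts' : Args Δ τs} →
          t ≈ t' → ts ≈A ts' → (t ∷ ts) ≈A (t' ∷ ts')

  infixr 5 _∧ᶠ_
  infixr 4 _∨ᶠ_
  infixr 3 _⊃ᶠ_

  data Fm (Δ : Ctx) : Set where
    natᶠ  : Tm Δ nt → Fm Δ
    eqᶠ   : Tm Δ nt → Tm Δ nt → Fm Δ
    pred  : (p : Pred) → Args Δ (predTy p) → Fm Δ
    ⊥ᶠ ⊤ᶠ : Fm Δ
    _∧ᶠ_ _∨ᶠ_ _⊃ᶠ_ : Fm Δ → Fm Δ → Fm Δ
    ∀ᶠ ∃ᶠ : (τ : Type) → Fm (τ ∷ Δ) → Fm Δ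

  data Atomic {Δ : Ctx} : Fm Δ → Set where
    at-nat  : ∀ {t} → Atomic (natᶠ t)
    at-eq   : ∀ {t u} → Atomic (eqᶠ t u)
    at-pred : ∀ {p ts} → Atomic (pred p ts)

  renF : ∀ {Δ Δ'} → Ren Δ Δ' → Fm Δ → Fm Δ'
  renF r (natᶠ t)   = natᶠ (ren r t)
  renF r (eqᶠ t u)  = eqᶠ (ren r t) (ren r u)
  renF r (pred p ts) = pred p (renA r ts)
  renF r ⊥ᶠ         = ⊥ᶠ
  renF r ⊤ᶠ         = ⊤ᶠ
  renF r (A ∧ᶠ B)   = renF r A ∧ᶠ renF r B
  renF r (A ∨ᶠ B)   = renF r A ∨ᶠ renF r B
  renF r (A ⊃ᶠ B)   = renF r A ⊃ᶠ renF r B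
  renF r (∀ᶠ τ A)   = ∀ᶠ τ (renF (ext r) A)
  renF r (∃ᶠ τ A)   = ∃ᶠ τ (renF (ext r) A)

  subF : ∀ {Δ Δ'} → Sub Δ Δ' → Fm Δ → Fm Δ'
  subF s (natᶠ t)   = natᶠ (sub s t)
  subF s (eqᶠ t u)  = eqᶠ (sub s t) (sub s u)
  subF s (pred p ts) = pred p (subA s ts)
  subF s ⊥ᶠ         = ⊥ᶠ
  subF s ⊤ᶠ         = ⊤ᶠ
  subF s (A ∧ᶠ B)   = subF s A ∧ᶠ subF s B
  subF s (A ∨ᶠ B)   = subF s A ∨ᶠ subF s B
  subF s (A ⊃ᶠ B)   = subF s A ⊃ᶠ subF s B
  subF s (∀ᶠ τ A)   = ∀ᶠ τ (subF (exts s) A)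
  subF s (∃ᶠ τ A)   = ∃ᶠ τ (subF (exts s) A)

  infix 4 _≈F_
  data _≈F_ {Δ : Ctx} : Fm Δ → Fm Δ → Set where
    c-nat  : ∀ {t t'} → t ≈ t' → natᶠ t ≈F natᶠ t'
    c-eq   : ∀ {t t' u u'} → t ≈ t' → u ≈ u' → eqᶠ t u ≈F eqᶠ t' u'
    c-pred : ∀ {p ts ts'} → ts ≈A ts' → pred p ts ≈F pred p ts'
    c-⊥    : ⊥ᶠ ≈F ⊥ᶠ
    c-⊤    : ⊤ᶠ ≈F ⊤ᶠ
    c-∧    : ∀ {A A' B B'} → A ≈F A' → B ≈F B' → (A ∧ᶠ B) ≈F (A' ∧ᶠ B')
    c-∨    : ∀ {A A' B B'} → A ≈F A' → B ≈F B' → (A ∨ᶠ B) ≈F (A' ∨ᶠ B')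
    c-⊃    : ∀ {A A' B B'} → A ≈F A' → B ≈F B' → (A ⊃ᶠ B) ≈F (A' ⊃ᶠ B')
    c-∀    : ∀ {τ A A'} → A ≈F A' → ∀ᶠ τ A ≈F ∀ᶠ τ A'
    c-∃    : ∀ {τ A A'} → A ≈F A' → ∃ᶠ τ A ≈F ∃ᶠ τ A'

  wkΓ : ∀ {Δ σ} → List (Fm Δ) → List (Fm (σ ∷ Δ))
  wkΓ = map (renF there)

  wkF : ∀ {Δ σ} → Fm Δ → Fm (σ ∷ Δ)
  wkF = renF there

  -- B (s j) for B : nt → o represented as a body with bound variable 0
  sj : ∀ {Δ} → Sub (nt ∷ Δ) (nt ∷ Δ)
  sj here      = app sc (var here)
  sj (there x) = var (there x)

  -- Unification for the definition D(eq) = { ∀x [ x = x ≜ ⊤ ] }.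
  -- The clause variable x is renamed apart as variable 0 of (nt ∷ Δ).
  -- θ unifies  eq u₁ u₂  and  eq x x  (up to βη):
  Unifier : ∀ {Δ Δ'} → Tm Δ nt → Tm Δ nt → Sub (nt ∷ Δ) Δ' → Set
  Unifier u₁ u₂ θ = (sub θ (ren there u₁) ≈ θ here) × (sub θ (ren there u₂) ≈ θ here)

  InstanceOf : ∀ {Δ₀ Δ' Δ''} → Sub Δ₀ Δ'' → Sub Δ₀ Δ' → Set
  InstanceOf {Δ' = Δ'} {Δ'' = Δ''} σ θ =
    Σ (Sub Δ' Δ'') λ ρ → ∀ {τ} (x : _ ∋ τ) → σ x ≈ sub ρ (θ x)

  SubSet : Ctx → Set₁
  SubSet Δ₀ = ∀ {Δ'} → Sub Δ₀ Δ' → Set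

  CSU : ∀ {Δ} → Tm Δ nt → Tm Δ nt → SubSet (nt ∷ Δ) → Set
  CSU {Δ} u₁ u₂ S =
    (∀ {Δ'} (θ : Sub (nt ∷ Δ) Δ') → S θ → Unifier u₁ u₂ θ) ×
    (∀ {Δ''} (σ : Sub (nt ∷ Δ) Δ'') → Unifier u₁ u₂ σ →
       Σ Ctx λ Δ' → Σ (Sub (nt ∷ Δ) Δ') λ θ → S θ × InstanceOf σ θ)

  restr : ∀ {Δ Δ'} → Sub (nt ∷ Δ) Δ' → Sub Δ Δ'
  restr θ x = θ (there x)

  -- Sequents  Δ ; Γ ⟶ C  (Δ: eigenvariables, Γ: multiset as list + exchange)
  infix 2 _⨾_⟶_
  data _⨾_⟶_ : (Δ : Ctx) → List (Fm Δ) → Fm Δ → Set₁ where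
    ⊥L   : ∀ {Δ Γ C} → Δ ⨾ ⊥ᶠ ∷ Γ ⟶ C
    ⊤R   : ∀ {Δ Γ} → Δ ⨾ Γ ⟶ ⊤ᶠ
    init : ∀ {Δ Γ A} → Atomic A → Δ ⨾ A ∷ Γ ⟶ A
    ∧L₁  : ∀ {Δ Γ A B C} → Δ ⨾ A ∷ Γ ⟶ C → Δ ⨾ (A ∧ᶠ B) ∷ Γ ⟶ C
    ∧L₂  : ∀ {Δ Γ A B C} → Δ ⨾ B ∷ Γ ⟶ C → Δ ⨾ (A ∧ᶠ B) ∷ Γ ⟶ C
    ∧R   : ∀ {Δ Γ A B} → Δ ⨾ Γ ⟶ A → Δ ⨾ Γ ⟶ B → Δ ⨾ Γ ⟶ A ∧ᶠ B
    ∨L   : ∀ {Δ Γ A B C} → Δ ⨾ A ∷ Γ ⟶ C → Δ ⨾ B ∷ Γ ⟶ C → Δ ⨾ (A ∨ᶠ B) ∷ Γ ⟶ C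
    ∨R₁  : ∀ {Δ Γ A B} → Δ ⨾ Γ ⟶ A → Δ ⨾ Γ ⟶ A ∨ᶠ B
    ∨R₂  : ∀ {Δ Γ A B} → Δ ⨾ Γ ⟶ B → Δ ⨾ Γ ⟶ A ∨ᶠ B
    ⊃L   : ∀ {Δ Γ A B C} → Δ ⨾ Γ ⟶ A → Δ ⨾ B ∷ Γ ⟶ C → Δ ⨾ (A ⊃ᶠ B) ∷ Γ ⟶ C
    ⊃R   : ∀ {Δ Γ A B} → Δ ⨾ A ∷ Γ ⟶ B → Δ ⨾ Γ ⟶ A ⊃ᶠ B
    ∀L   : ∀ {Δ Γ τ B C} (t : Tm Δ τ) → Δ ⨾ subF (σ₀ t) B ∷ Γ ⟶ C → Δ ⨾ ∀ᶠ τ B ∷ Γ ⟶ C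
    ∀R   : ∀ {Δ Γ τ B} → (τ ∷ Δ) ⨾ wkΓ Γ ⟶ B → Δ ⨾ Γ ⟶ ∀ᶠ τ B
    ∃L   : ∀ {Δ Γ τ B C} → (τ ∷ Δ) ⨾ B ∷ wkΓ Γ ⟶ wkF C → Δ ⨾ ∃ᶠ τ B ∷ Γ ⟶ C
    ∃R   : ∀ {Δ Γ τ B} (t : Tm Δ τ) → Δ ⨾ Γ ⟶ subF (σ₀ t) B → Δ ⨾ Γ ⟶ ∃ᶠ τ B
    contr : ∀ {Δ Γ A C} → Δ ⨾ A ∷ A ∷ Γ ⟶ C → Δ ⨾ A ∷ Γ ⟶ C
    cut  : ∀ {Δ Γ A C} → Δ ⨾ Γ ⟶ A → Δ ⨾ A ∷ Γ ⟶ C → Δ ⨾ Γ ⟶ C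
    -- multiset structure and αβη-identification
    exch : ∀ {Δ Γ Γ' C} → Γ ↭ Γ' → Δ ⨾ Γ ⟶ C → Δ ⨾ Γ' ⟶ C
    conv : ∀ {Δ Γ Γ' C C'} → Pointwise _≈F_ Γ Γ' → C ≈F C' →
           Δ ⨾ Γ ⟶ C → Δ ⨾ Γ' ⟶ C'
    natZ : ∀ {Δ Γ} → Δ ⨾ Γ ⟶ natᶠ zc
    natS : ∀ {Δ Γ I} → Δ ⨾ Γ ⟶ natᶠ I → Δ ⨾ Γ ⟶ natᶠ (app sc I)
    natI : ∀ {Δ Γ C I} (B : Fm (nt ∷ Δ)) →
           Δ ⨾ [] ⟶ subF (σ₀ zc) B →
           (nt ∷ Δ) ⨾ B ∷ [] ⟶ subF sj B →
           Δ ⨾ subF (σ₀ I) B ∷ Γ ⟶ C →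
           Δ ⨾ natᶠ I ∷ Γ ⟶ C
    defR : ∀ {Δ Γ t} → Δ ⨾ Γ ⟶ ⊤ᶠ → Δ ⨾ Γ ⟶ eqᶠ t t
    defL : ∀ {Δ Γ C u₁ u₂} (S : SubSet (nt ∷ Δ)) → CSU u₁ u₂ S →
           (∀ {Δ'} (θ : Sub (nt ∷ Δ) Δ') → S θ →
              Δ' ⨾ ⊤ᶠ ∷ map (subF (restr θ)) Γ ⟶ subF (restr θ) C) →
           Δ ⨾ eqᶠ u₁ u₂ ∷ Γ ⟶ C

  Derivable : Fm [] → Set₁
  Derivable F = [] ⨾ [] ⟶ F

  Env : Ctx → Set
  Env Δ = ℕ → Tm Δ nt

  extEnv : ∀ {Δ} → Env Δ → ℕ → Env (nt ∷ Δ)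
  extEnv ρ x y = if x ≡ᵇ y then var here else ren there (ρ y)

  transT : ∀ {Δ} → Env Δ → ITm → Tm Δ nt
  transT ρ (ivar x) = ρ x
  transT ρ iz       = zc
  transT ρ (is t)   = app sc (transT ρ t)

  transF : ∀ {Δ} → Env Δ → IFm → Fm Δ
  transF ρ (a ≐ b)  = eqᶠ (transT ρ a) (transT ρ b)
  transF ρ ⊥ⁱ       = ⊥ᶠ
  transF ρ ⊤ⁱ       = ⊤ᶠ
  transF ρ (A ∧ⁱ B) = transF ρ A ∧ᶠ transF ρ B
  transF ρ (A ∨ⁱ B) = transF ρ A ∨ᶠ transF ρ B
  transF ρ (A ⊃ⁱ B) = transF ρ A ⊃ᶠ transF ρ B
  transF ρ (∀ⁱ x A) = ∀ᶠ nt (natᶠ (var here) ⊃ᶠ transF (extEnv ρ x) A)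
  transF ρ (∃ⁱ x A) = ∃ᶠ nt (natᶠ (var here) ∧ᶠ transF (extEnv ρ x) A)

  -- translation of a closed formula (the default environment is never
  -- consulted for closed formulas)
  _° : IFm → Fm []
  C ° = transF (λ _ → zc) C

-- Read an IPA formula in FOλ^{ΔN} under an environment sending each variable to a term
-- t for which nat t is among the hypotheses, and call the formula valid if its reading is
-- derivable under every such environment. Modus ponens and generalization preserve
-- validity, so it suffices that every axiom is valid. For the logical axioms and induction
-- this is a matter of the sequent rules (induction uses natI with an invariant strengthened
-- to carry nat j and the induction hypothesis). For equality, the left rule of D(eq) with
-- the complete set of all unifiers reduces the axioms to two facts about βη-conversion:
-- z is not convertible to s a, and s is injective up to conversion. Both are read off a
-- glued normalization model, in which natural-number values are built from zero, suc and
-- neutral terms.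

module Submission where

open import Defs
open import Data.Nat using (ℕ; zero; suc; _≡ᵇ_; _≟_)
open import Data.Bool using (true; false; if_then_else_)
open import Data.List using (List; []; _∷_; map)
open import Data.List.Membership.Propositional using (_∈_)
open import Data.List.Membership.Propositional.Properties using (∈-∃++; ∈-map⁺)
open import Data.List.Relation.Unary.Any using (here; there)
open import Data.List.Relation.Unary.All as All using (All; []; _∷_)
open import Data.List.Relation.Binary.Permutation.Propositional using (↭-refl; ↭-sym; ↭-swap)
open import Data.List.Relation.Binary.Permutation.Propositional.Properties using (shift)
import Data.List.Relation.Binary.Pointwise as PW
open import Data.Product using (_×_; _,_; proj₁; proj₂)
open import Data.Sum using (inj₁; inj₂)
open import Data.Empty using (⊥-elim)
open import Relation.Binary.PropositionalEquality
  using (_≡_; _≢_; refl; sym; trans; cong; cong₂; subst; ≢-sym)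
open import Relation.Nullary using (¬_; yes; no)

module Soundness (Sg : Signature) where
  open Signature Sg
  open Sys Sg

  -- Substitution calculus

  infix 4 _≗ˢ_
  _≗ˢ_ : ∀ {Δ Δ'} → Sub Δ Δ' → Sub Δ Δ' → Set
  s ≗ˢ s' = ∀ {τ} (x : _ ∋ τ) → s x ≡ s' x

  infixl 5 _▷_
  _▷_ : ∀ {Δ Δ' σ} → Sub Δ Δ' → Tm Δ' σ → Sub (σ ∷ Δ) Δ'
  (s ▷ u) here      = u
  (s ▷ u) (there x) = s x

  exts-cong : ∀ {Δ Δ' σ} {s s' : Sub Δ Δ'} → s ≗ˢ s' → exts {σ = σ} s ≗ˢ exts s'
  exts-cong e here      = refl
  exts-cong e (there x) = cong (ren there) (e x)

  sub-cong : ∀ {Δ Δ' τ} {s s' : Sub Δ Δ'} → s ≗ˢ s' → (t : Tm Δ τ) → sub s t ≡ sub s' t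
  sub-cong e (var x)   = e x
  sub-cong e (con c)   = refl
  sub-cong e zc        = refl
  sub-cong e sc        = refl
  sub-cong e (lam t)   = cong lam (sub-cong (exts-cong e) t)
  sub-cong e (app t u) = cong₂ app (sub-cong e t) (sub-cong e u)

  var-ext : ∀ {Δ Δ' σ} (r : Ren Δ Δ') →
            (λ {τ} (x : (σ ∷ Δ) ∋ τ) → var (ext r x)) ≗ˢ exts (λ x → var (r x))
  var-ext r here      = refl
  var-ext r (there x) = refl

  ren≡sub : ∀ {Δ Δ' τ} (r : Ren Δ Δ') (t : Tm Δ τ) → ren r t ≡ sub (λ x → var (r x)) t
  ren≡sub r (var x)   = refl
  ren≡sub r (con c)   = refl
  ren≡sub r zc        = refl
  ren≡sub r sc        = refl
  ren≡sub r (lam t)   = cong lam (trans (ren≡sub (ext r) t) (sub-cong (var-ext r) t))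
  ren≡sub r (app t u) = cong₂ app (ren≡sub r t) (ren≡sub r u)

  sub-ren : ∀ {Δ Δ' Δ'' τ} (s : Sub Δ' Δ'') (r : Ren Δ Δ') (t : Tm Δ τ) →
            sub s (ren r t) ≡ sub (λ x → s (r x)) t
  sub-ren s r (var x)   = refl
  sub-ren s r (con c)   = refl
  sub-ren s r zc        = refl
  sub-ren s r sc        = refl
  sub-ren s r (lam t)   =
    cong lam (trans (sub-ren (exts s) (ext r) t) (sub-cong (λ { here → refl ; (there x) → refl }) t))
  sub-ren s r (app t u) = cong₂ app (sub-ren s r t) (sub-ren s r u)

  ren-ren : ∀ {Δ Δ' Δ'' τ} (r' : Ren Δ' Δ'') (r : Ren Δ Δ') (t : Tm Δ τ) →
            ren r' (ren r t) ≡ ren (λ x → r' (r x)) t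
  ren-ren r' r t = trans (ren≡sub r' (ren r t)) (trans (sub-ren _ r t) (sym (ren≡sub _ t)))

  ren-sub : ∀ {Δ Δ' Δ'' τ} (r : Ren Δ' Δ'') (s : Sub Δ Δ') (t : Tm Δ τ) →
            ren r (sub s t) ≡ sub (λ x → ren r (s x)) t
  ren-sub r s (var x)   = refl
  ren-sub r s (con c)   = refl
  ren-sub r s zc        = refl
  ren-sub r s sc        = refl
  ren-sub r s (lam t)   = cong lam (trans (ren-sub (ext r) (exts s) t) (sub-cong ext-exts t))
    where
      ext-exts : (λ {τ} x → ren (ext r) (exts s x)) ≗ˢ exts (λ x → ren r (s x))
      ext-exts here      = refl
      ext-exts (there x) = trans (ren-ren (ext r) there (s x)) (sym (ren-ren there r (s x)))
  ren-sub r s (app t u) = cong₂ app (ren-sub r s t) (ren-sub r s u)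

  sub-exts-wk : ∀ {Δ Δ' σ τ} (s : Sub Δ Δ') (t : Tm Δ τ) →
                sub (exts {σ = σ} s) (ren there t) ≡ ren there (sub s t)
  sub-exts-wk s t = trans (sub-ren (exts s) there t) (sym (ren-sub there s t))

  sub-sub : ∀ {Δ Δ' Δ'' τ} (s' : Sub Δ' Δ'') (s : Sub Δ Δ') (t : Tm Δ τ) →
            sub s' (sub s t) ≡ sub (λ x → sub s' (s x)) t
  sub-sub s' s (var x)   = refl
  sub-sub s' s (con c)   = refl
  sub-sub s' s zc        = refl
  sub-sub s' s sc        = refl
  sub-sub s' s (lam t)   =
    cong lam (trans (sub-sub (exts s') (exts s) t)
                    (sub-cong (λ { here → refl ; (there x) → sub-exts-wk s' (s x) }) t))
  sub-sub s' s (app t u) = cong₂ app (sub-sub s' s t) (sub-sub s' s u)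

  sub-id : ∀ {Δ τ} (t : Tm Δ τ) → sub var t ≡ t
  sub-id (var x)   = refl
  sub-id (con c)   = refl
  sub-id zc        = refl
  sub-id sc        = refl
  sub-id (lam t)   = cong lam (trans (sub-cong (λ { here → refl ; (there x) → refl }) t) (sub-id t))
  sub-id (app t u) = cong₂ app (sub-id t) (sub-id u)

  sub-σ₀-wk : ∀ {Δ σ τ} (u : Tm Δ σ) (t : Tm Δ τ) → sub (σ₀ u) (ren there t) ≡ t
  sub-σ₀-wk u t = trans (sub-ren _ there t) (sub-id t)

  sub-σ₀-exts : ∀ {Δ Δ' σ τ} (s : Sub Δ Δ') (u : Tm Δ' σ) (t : Tm (σ ∷ Δ) τ) →
                sub (σ₀ u) (sub (exts s) t) ≡ sub (s ▷ u) t
  sub-σ₀-exts s u t =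
    trans (sub-sub _ _ t) (sub-cong (λ { here → refl ; (there x) → sub-σ₀-wk u (s x) }) t)

  ≡⇒≈ : ∀ {Δ τ} {t u : Tm Δ τ} → t ≡ u → t ≈ u
  ≡⇒≈ refl = ≈refl

  sub-≈ : ∀ {Δ Δ' τ} (s : Sub Δ Δ') {t u : Tm Δ τ} → t ≈ u → sub s t ≈ sub s u
  sub-≈ s (β {t = t} {u = u}) =
    ≈trans β (≡⇒≈ (trans (sub-σ₀-exts s (sub s u) t)
                  (sym (trans (sub-sub s (σ₀ u) t) (sub-cong (λ { here → refl ; (there x) → refl }) t)))))
  sub-≈ s (η {t = t})  = ≈trans (≈lam (≈app (≡⇒≈ (sub-exts-wk s t)) ≈refl)) η
  sub-≈ s ≈refl        = ≈refl
  sub-≈ s (≈sym p)     = ≈sym (sub-≈ s p)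
  sub-≈ s (≈trans p q) = ≈trans (sub-≈ s p) (sub-≈ s q)
  sub-≈ s (≈lam p)     = ≈lam (sub-≈ (exts s) p)
  sub-≈ s (≈app p q)   = ≈app (sub-≈ s p) (sub-≈ s q)

  ren-≈ : ∀ {Δ Δ' τ} (r : Ren Δ Δ') {t u : Tm Δ τ} → t ≈ u → ren r t ≈ ren r u
  ren-≈ r {t} {u} p = ≈trans (≡⇒≈ (ren≡sub r t)) (≈trans (sub-≈ _ p) (≡⇒≈ (sym (ren≡sub r u))))

  sub-cong-≈ : ∀ {Δ Δ' τ} {s s' : Sub Δ Δ'} → (∀ {σ} (x : Δ ∋ σ) → s x ≈ s' x) →
               (t : Tm Δ τ) → sub s t ≈ sub s' t
  sub-cong-≈ e (var x)   = e x
  sub-cong-≈ e (con c)   = ≈refl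
  sub-cong-≈ e zc        = ≈refl
  sub-cong-≈ e sc        = ≈refl
  sub-cong-≈ e (lam t)   = ≈lam (sub-cong-≈ (λ { here → ≈refl ; (there x) → ren-≈ there (e x) }) t)
  sub-cong-≈ e (app t u) = ≈app (sub-cong-≈ e t) (sub-cong-≈ e u)

  subA-cong : ∀ {Δ Δ' τs} {s s' : Sub Δ Δ'} → s ≗ˢ s' → (ts : Args Δ τs) → subA s ts ≡ subA s' ts
  subA-cong e []       = refl
  subA-cong e (t ∷ ts) = cong₂ _∷_ (sub-cong e t) (subA-cong e ts)

  subF-cong : ∀ {Δ Δ'} {s s' : Sub Δ Δ'} → s ≗ˢ s' → (A : Fm Δ) → subF s A ≡ subF s' A
  subF-cong e (natᶠ t)    = cong natᶠ (sub-cong e t)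
  subF-cong e (eqᶠ t u)   = cong₂ eqᶠ (sub-cong e t) (sub-cong e u)
  subF-cong e (pred p ts) = cong (pred p) (subA-cong e ts)
  subF-cong e ⊥ᶠ          = refl
  subF-cong e ⊤ᶠ          = refl
  subF-cong e (A ∧ᶠ B)    = cong₂ _∧ᶠ_ (subF-cong e A) (subF-cong e B)
  subF-cong e (A ∨ᶠ B)    = cong₂ _∨ᶠ_ (subF-cong e A) (subF-cong e B)
  subF-cong e (A ⊃ᶠ B)    = cong₂ _⊃ᶠ_ (subF-cong e A) (subF-cong e B)
  subF-cong e (∀ᶠ τ A)    = cong (∀ᶠ τ) (subF-cong (exts-cong e) A)
  subF-cong e (∃ᶠ τ A)    = cong (∃ᶠ τ) (subF-cong (exts-cong e) A)

  renA≡subA : ∀ {Δ Δ' τs} (r : Ren Δ Δ') (ts : Args Δ τs) → renA r ts ≡ subA (λ x → var (r x)) ts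
  renA≡subA r []       = refl
  renA≡subA r (t ∷ ts) = cong₂ _∷_ (ren≡sub r t) (renA≡subA r ts)

  renF≡subF : ∀ {Δ Δ'} (r : Ren Δ Δ') (A : Fm Δ) → renF r A ≡ subF (λ x → var (r x)) A
  renF≡subF r (natᶠ t)    = cong natᶠ (ren≡sub r t)
  renF≡subF r (eqᶠ t u)   = cong₂ eqᶠ (ren≡sub r t) (ren≡sub r u)
  renF≡subF r (pred p ts) = cong (pred p) (renA≡subA r ts)
  renF≡subF r ⊥ᶠ          = refl
  renF≡subF r ⊤ᶠ          = refl
  renF≡subF r (A ∧ᶠ B)    = cong₂ _∧ᶠ_ (renF≡subF r A) (renF≡subF r B)
  renF≡subF r (A ∨ᶠ B)    = cong₂ _∨ᶠ_ (renF≡subF r A) (renF≡subF r B)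
  renF≡subF r (A ⊃ᶠ B)    = cong₂ _⊃ᶠ_ (renF≡subF r A) (renF≡subF r B)
  renF≡subF r (∀ᶠ τ A)    = cong (∀ᶠ τ) (trans (renF≡subF (ext r) A) (subF-cong (var-ext r) A))
  renF≡subF r (∃ᶠ τ A)    = cong (∃ᶠ τ) (trans (renF≡subF (ext r) A) (subF-cong (var-ext r) A))

  subA-subA : ∀ {Δ Δ' Δ'' τs} (s' : Sub Δ' Δ'') (s : Sub Δ Δ') (ts : Args Δ τs) →
              subA s' (subA s ts) ≡ subA (λ x → sub s' (s x)) ts
  subA-subA s' s []       = refl
  subA-subA s' s (t ∷ ts) = cong₂ _∷_ (sub-sub s' s t) (subA-subA s' s ts)

  exts-∘ : ∀ {Δ Δ' Δ'' σ} (s' : Sub Δ' Δ'') (s : Sub Δ Δ') →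
           (λ {τ} (x : (σ ∷ Δ) ∋ τ) → sub (exts s') (exts s x)) ≗ˢ exts (λ x → sub s' (s x))
  exts-∘ s' s here      = refl
  exts-∘ s' s (there x) = sub-exts-wk s' (s x)

  subF-subF : ∀ {Δ Δ' Δ''} (s' : Sub Δ' Δ'') (s : Sub Δ Δ') (A : Fm Δ) →
              subF s' (subF s A) ≡ subF (λ x → sub s' (s x)) A
  subF-subF s' s (natᶠ t)    = cong natᶠ (sub-sub s' s t)
  subF-subF s' s (eqᶠ t u)   = cong₂ eqᶠ (sub-sub s' s t) (sub-sub s' s u)
  subF-subF s' s (pred p ts) = cong (pred p) (subA-subA s' s ts)
  subF-subF s' s ⊥ᶠ          = refl
  subF-subF s' s ⊤ᶠ          = refl
  subF-subF s' s (A ∧ᶠ B)    = cong₂ _∧ᶠ_ (subF-subF s' s A) (subF-subF s' s B)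
  subF-subF s' s (A ∨ᶠ B)    = cong₂ _∨ᶠ_ (subF-subF s' s A) (subF-subF s' s B)
  subF-subF s' s (A ⊃ᶠ B)    = cong₂ _⊃ᶠ_ (subF-subF s' s A) (subF-subF s' s B)
  subF-subF s' s (∀ᶠ τ A)    =
    cong (∀ᶠ τ) (trans (subF-subF (exts s') (exts s) A) (subF-cong (exts-∘ s' s) A))
  subF-subF s' s (∃ᶠ τ A)    =
    cong (∃ᶠ τ) (trans (subF-subF (exts s') (exts s) A) (subF-cong (exts-∘ s' s) A))

  subA-id : ∀ {Δ τs} (ts : Args Δ τs) → subA var ts ≡ ts
  subA-id []       = refl
  subA-id (t ∷ ts) = cong₂ _∷_ (sub-id t) (subA-id ts)

  exts-var : ∀ {Δ σ} → exts {Δ} {Δ} {σ} var ≗ˢ var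
  exts-var here      = refl
  exts-var (there x) = refl

  subF-id : ∀ {Δ} (A : Fm Δ) → subF var A ≡ A
  subF-id (natᶠ t)    = cong natᶠ (sub-id t)
  subF-id (eqᶠ t u)   = cong₂ eqᶠ (sub-id t) (sub-id u)
  subF-id (pred p ts) = cong (pred p) (subA-id ts)
  subF-id ⊥ᶠ          = refl
  subF-id ⊤ᶠ          = refl
  subF-id (A ∧ᶠ B)    = cong₂ _∧ᶠ_ (subF-id A) (subF-id B)
  subF-id (A ∨ᶠ B)    = cong₂ _∨ᶠ_ (subF-id A) (subF-id B)
  subF-id (A ⊃ᶠ B)    = cong₂ _⊃ᶠ_ (subF-id A) (subF-id B)
  subF-id (∀ᶠ τ A)    = cong (∀ᶠ τ) (trans (subF-cong exts-var A) (subF-id A))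
  subF-id (∃ᶠ τ A)    = cong (∃ᶠ τ) (trans (subF-cong exts-var A) (subF-id A))

  subF-renF : ∀ {Δ Δ' Δ''} (s : Sub Δ' Δ'') (r : Ren Δ Δ') (A : Fm Δ) →
              subF s (renF r A) ≡ subF (λ x → s (r x)) A
  subF-renF s r A = trans (cong (subF s) (renF≡subF r A)) (subF-subF s _ A)

  renF-subF : ∀ {Δ Δ' Δ''} (r : Ren Δ' Δ'') (s : Sub Δ Δ') (A : Fm Δ) →
              renF r (subF s A) ≡ subF (λ x → ren r (s x)) A
  renF-subF r s A = trans (renF≡subF r (subF s A))
                          (trans (subF-subF _ s A) (subF-cong (λ x → sym (ren≡sub r (s x))) A))

  subF-σ₀-wk : ∀ {Δ τ} (u : Tm Δ τ) (A : Fm Δ) → subF (σ₀ u) (wkF A) ≡ A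
  subF-σ₀-wk u A = trans (subF-renF _ _ A) (subF-id A)

  subF-σ₀-var : ∀ {Δ τ} (A : Fm (τ ∷ Δ)) → subF (σ₀ (var here)) (renF (ext there) A) ≡ A
  subF-σ₀-var A =
    trans (subF-renF _ _ A) (trans (subF-cong (λ { here → refl ; (there x) → refl }) A) (subF-id A))

  reflA : ∀ {Δ τs} (ts : Args Δ τs) → ts ≈A ts
  reflA []       = []
  reflA (t ∷ ts) = ≈refl ∷ reflA ts

  reflF : ∀ {Δ} (A : Fm Δ) → A ≈F A
  reflF (natᶠ t)    = c-nat ≈refl
  reflF (eqᶠ t u)   = c-eq ≈refl ≈refl
  reflF (pred p ts) = c-pred (reflA ts)
  reflF ⊥ᶠ          = c-⊥
  reflF ⊤ᶠ          = c-⊤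
  reflF (A ∧ᶠ B)    = c-∧ (reflF A) (reflF B)
  reflF (A ∨ᶠ B)    = c-∨ (reflF A) (reflF B)
  reflF (A ⊃ᶠ B)    = c-⊃ (reflF A) (reflF B)
  reflF (∀ᶠ τ A)    = c-∀ (reflF A)
  reflF (∃ᶠ τ A)    = c-∃ (reflF A)

  -- A glued model of βη-conversion

  module Glued (Θ : Ctx) where

    data NatVal : Set where
      zero    : NatVal
      suc     : NatVal → NatVal
      neutral : Tm Θ nt → NatVal

    Val : Type → Set
    Val nt       = NatVal
    Val (base b) = Tm Θ (base b)
    Val (σ ⇒ τ)  = Tm Θ (σ ⇒ τ) × (Val σ → Val τ)

    reify : ∀ τ → Val τ → Tm Θ τ
    reify nt zero        = zc
    reify nt (suc n)     = app sc (reify nt n)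
    reify nt (neutral t) = t
    reify (base b) t     = t
    reify (σ ⇒ τ)        = proj₁

    reflect : ∀ τ → Tm Θ τ → Val τ
    reflect nt t       = neutral t
    reflect (base b) t = t
    reflect (σ ⇒ τ) t  = t , λ a → reflect τ (app t (reify σ a))

    reify-reflect : ∀ τ (t : Tm Θ τ) → reify τ (reflect τ t) ≡ t
    reify-reflect nt t       = refl
    reify-reflect (base b) t = refl
    reify-reflect (σ ⇒ τ) t  = refl

    Valuation : Ctx → Set
    Valuation Δ = ∀ {τ} → Δ ∋ τ → Val τ

    infixl 5 _▸_
    _▸_ : ∀ {Δ σ} → Valuation Δ → Val σ → Valuation (σ ∷ Δ)
    (γ ▸ a) here      = a
    (γ ▸ a) (there x) = γ x

    reifyᵛ : ∀ {Δ} → Valuation Δ → Sub Δ Θ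
    reifyᵛ γ x = reify _ (γ x)

    reifyᵛ-▸ : ∀ {Δ σ} {γ : Valuation Δ} {a : Val σ} → reifyᵛ γ ▷ reify σ a ≗ˢ reifyᵛ (γ ▸ a)
    reifyᵛ-▸ here      = refl
    reifyᵛ-▸ (there x) = refl

    -- A λ-abstraction evaluates to its substituted syntax paired with its semantic action,
    -- so reification never has to go under a binder.
    eval : ∀ {Δ τ} → Tm Δ τ → Valuation Δ → Val τ
    eval (var x)   γ = γ x
    eval (con c)   γ = reflect _ (con c)
    eval zc        γ = zero
    eval sc        γ = sc , suc
    eval (lam t)   γ = sub (reifyᵛ γ) (lam t) , λ a → eval t (γ ▸ a)
    eval (app t u) γ = proj₂ (eval t γ) (eval u γ)

    infix 4 _≋ℕ_
    data _≋ℕ_ : NatVal → NatVal → Set where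
      zero    : zero ≋ℕ zero
      suc     : ∀ {m n} → m ≋ℕ n → suc m ≋ℕ suc n
      neutral : ∀ {t u} → t ≈ u → neutral t ≋ℕ neutral u

    -- Besides extensionality, equality of function values asks that the semantic
    -- action agree with application of the term component (coherence).
    Equal : ∀ τ → Val τ → Val τ → Set
    Equal nt       m n = m ≋ℕ n
    Equal (base b) t u = t ≈ u
    Equal (σ ⇒ τ) (t , f) (u , g) =
      t ≈ u ×
      (∀ {a b} → Equal σ a b → Equal τ (f a) (g b)) ×
      (∀ {a} → Equal σ a a → reify τ (f a) ≈ app t (reify σ a))

    reify-Equal : ∀ τ {a b} → Equal τ a b → reify τ a ≈ reify τ b
    reify-Equal nt zero         = ≈refl
    reify-Equal nt (suc p)      = ≈app ≈refl (reify-Equal nt p)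
    reify-Equal nt (neutral p)  = p
    reify-Equal (base b) p      = p
    reify-Equal (σ ⇒ τ) (p , _) = p

    Equal-sym : ∀ τ {a b} → Equal τ a b → Equal τ b a
    Equal-sym nt zero        = zero
    Equal-sym nt (suc p)     = suc (Equal-sym nt p)
    Equal-sym nt (neutral p) = neutral (≈sym p)
    Equal-sym (base b) p     = ≈sym p
    Equal-sym (σ ⇒ τ) (p , F , coh) =
      ≈sym p ,
      (λ q → Equal-sym τ (F (Equal-sym σ q))) ,
      (λ q → ≈trans (reify-Equal τ (Equal-sym τ (F q))) (≈trans (coh q) (≈app p ≈refl)))

    Equal-trans : ∀ τ {a b c} → Equal τ a b → Equal τ b c → Equal τ a c
    Equal-trans nt zero zero               = zero
    Equal-trans nt (suc p) (suc q)         = suc (Equal-trans nt p q)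
    Equal-trans nt (neutral p) (neutral q) = neutral (≈trans p q)
    Equal-trans (base b) p q               = ≈trans p q
    Equal-trans (σ ⇒ τ) (p , F , coh) (q , G , _) =
      ≈trans p q ,
      (λ r → Equal-trans τ (F r) (G (Equal-trans σ (Equal-sym σ r) r))) ,
      coh

    Equal-reflˡ : ∀ τ {a b} → Equal τ a b → Equal τ a a
    Equal-reflˡ τ p = Equal-trans τ p (Equal-sym τ p)

    Equal-app : ∀ {σ τ f g} → Equal (σ ⇒ τ) f g →
                ∀ {a b} → Equal σ a b → Equal τ (proj₂ f a) (proj₂ g b)
    Equal-app (_ , F , _) = F

    Equal-coherent : ∀ {σ τ f g} → Equal (σ ⇒ τ) f g →
                     ∀ {a} → Equal σ a a → reify τ (proj₂ f a) ≈ app (proj₁ f) (reify σ a)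
    Equal-coherent (_ , _ , coh) = coh

    reflect-Equal : ∀ τ {t u : Tm Θ τ} → t ≈ u → Equal τ (reflect τ t) (reflect τ u)
    reflect-Equal nt p       = neutral p
    reflect-Equal (base b) p = p
    reflect-Equal (σ ⇒ τ) {t} p =
      p ,
      (λ q → reflect-Equal τ (≈app p (reify-Equal σ q))) ,
      (λ {a} _ → ≡⇒≈ (reify-reflect τ (app t (reify σ a))))

    infix 4 _≋_
    _≋_ : ∀ {Δ} → Valuation Δ → Valuation Δ → Set
    γ ≋ γ' = ∀ {τ} (x : _ ∋ τ) → Equal τ (γ x) (γ' x)

    ≋-reflˡ : ∀ {Δ} {γ γ' : Valuation Δ} → γ ≋ γ' → γ ≋ γ
    ≋-reflˡ e x = Equal-reflˡ _ (e x)

    ≋-sym : ∀ {Δ} {γ γ' : Valuation Δ} → γ ≋ γ' → γ' ≋ γ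
    ≋-sym e x = Equal-sym _ (e x)

    ≋-reflʳ : ∀ {Δ} {γ γ' : Valuation Δ} → γ ≋ γ' → γ' ≋ γ'
    ≋-reflʳ e = ≋-reflˡ (≋-sym e)

    ▸-≋ : ∀ {Δ σ} {γ γ' : Valuation Δ} {a b : Val σ} → γ ≋ γ' → Equal σ a b → γ ▸ a ≋ γ' ▸ b
    ▸-≋ e p here      = p
    ▸-≋ e p (there x) = e x

    mutual
      eval-Equal : ∀ {Δ τ} (t : Tm Δ τ) {γ γ' : Valuation Δ} → γ ≋ γ' →
                   Equal τ (eval t γ) (eval t γ')
      eval-Equal (var x)   e = e x
      eval-Equal (con c)   e = reflect-Equal _ ≈refl
      eval-Equal zc        e = zero
      eval-Equal sc        e = ≈refl , suc , λ _ → ≈refl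
      eval-Equal (lam t) {γ} e =
        sub-cong-≈ (λ x → reify-Equal _ (e x)) (lam t) ,
        (λ p → eval-Equal t (▸-≋ e p)) ,
        λ {a} p → ≈trans (eval-reify t (▸-≋ (≋-reflˡ e) p))
                         (≈sym (≈trans β (≡⇒≈ (trans (sub-σ₀-exts (reifyᵛ γ) (reify _ a) t)
                                                      (sub-cong reifyᵛ-▸ t)))))
      eval-Equal (app t u) e = Equal-app (eval-Equal t e) (eval-Equal u e)

      eval-reify : ∀ {Δ τ} (t : Tm Δ τ) {γ : Valuation Δ} → γ ≋ γ →
                   reify τ (eval t γ) ≈ sub (reifyᵛ γ) t
      eval-reify (var x)   e = ≈refl
      eval-reify (con c)   e = ≡⇒≈ (reify-reflect _ (con c))
      eval-reify zc        e = ≈refl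
      eval-reify sc        e = ≈refl
      eval-reify (lam t)   e = ≈refl
      eval-reify (app t u) e =
        ≈trans (Equal-coherent (eval-Equal t e) (eval-Equal u e))
               (≈app (eval-reify t e) (eval-reify u e))

    eval-ren : ∀ {Δ Δ₁ τ} (t : Tm Δ τ) (r : Ren Δ Δ₁) {γ : Valuation Δ₁} {ζ : Valuation Δ} →
               γ ≋ γ → (∀ {σ} (x : Δ ∋ σ) → Equal σ (γ (r x)) (ζ x)) →
               Equal τ (eval (ren r t) γ) (eval t ζ)
    eval-ren (var x)   r eγ h = h x
    eval-ren (con c)   r eγ h = reflect-Equal _ ≈refl
    eval-ren zc        r eγ h = zero
    eval-ren sc        r eγ h = ≈refl , suc , λ _ → ≈refl
    eval-ren (lam t)   r {γ} eγ h =
      ≈trans (≡⇒≈ (sub-ren (reifyᵛ γ) r (lam t))) (sub-cong-≈ (λ x → reify-Equal _ (h x)) (lam t)) ,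
      (λ p → eval-ren t (ext r) (▸-≋ eγ (Equal-reflˡ _ p)) λ { here → p ; (there x) → h x }) ,
      Equal-coherent (eval-Equal (ren r (lam t)) eγ)
    eval-ren (app t u) r eγ h = Equal-app (eval-ren t r eγ h) (eval-ren u r eγ h)

    eval-sub : ∀ {Δ Δ₁ τ} (t : Tm Δ τ) (s : Sub Δ Δ₁) {γ : Valuation Δ₁} {ζ : Valuation Δ} →
               γ ≋ γ → (∀ {σ} (x : Δ ∋ σ) → Equal σ (eval (s x) γ) (ζ x)) →
               Equal τ (eval (sub s t) γ) (eval t ζ)
    eval-sub (var x)   s eγ h = h x
    eval-sub (con c)   s eγ h = reflect-Equal _ ≈refl
    eval-sub zc        s eγ h = zero
    eval-sub sc        s eγ h = ≈refl , suc , λ _ → ≈refl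
    eval-sub (lam t)   s {γ} eγ h =
      ≈trans (≡⇒≈ (sub-sub (reifyᵛ γ) s (lam t)))
             (sub-cong-≈ (λ x → ≈trans (≈sym (eval-reify (s x) eγ)) (reify-Equal _ (h x))) (lam t)) ,
      (λ p → eval-sub t (exts s) (▸-≋ eγ (Equal-reflˡ _ p))
               λ { here → p
                 ; (there x) → Equal-trans _ (eval-ren (s x) there (▸-≋ eγ (Equal-reflˡ _ p)) eγ) (h x) }) ,
      Equal-coherent (eval-Equal (sub s (lam t)) eγ)
    eval-sub (app t u) s eγ h = Equal-app (eval-sub t s eγ h) (eval-sub u s eγ h)

    eval-≈ : ∀ {Δ τ} {t u : Tm Δ τ} → t ≈ u → {γ γ' : Valuation Δ} → γ ≋ γ' →
             Equal τ (eval t γ) (eval u γ')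
    eval-≈ (β {t = t} {u = u}) e =
      Equal-sym _ (eval-sub t (σ₀ u) (≋-reflʳ e)
        λ { here → Equal-sym _ (eval-Equal u e) ; (there x) → ≋-sym e x })
    eval-≈ (η {σ = σ} {τ} {t = t}) {γ} e =
      ≈trans (≈lam (≈app (≡⇒≈ (sub-exts-wk (reifyᵛ γ) t)) ≈refl))
        (≈trans η (≈trans (≈sym (eval-reify t (≋-reflˡ e))) (reify-Equal _ (eval-Equal t e)))) ,
      (λ p → Equal-app (Equal-trans (σ ⇒ τ)
                          (eval-ren t there (▸-≋ (≋-reflˡ e) (Equal-reflˡ σ p)) (≋-reflˡ e))
                          (eval-Equal t e)) p) ,
      Equal-coherent (eval-Equal (lam (app (ren there t) (var here))) (≋-reflˡ e))
    eval-≈ (≈refl {t = t}) e = eval-Equal t e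
    eval-≈ (≈sym p)       e = Equal-sym _ (eval-≈ p (≋-sym e))
    eval-≈ (≈trans p q)   e = Equal-trans _ (eval-≈ p e) (eval-≈ q (≋-reflʳ e))
    eval-≈ (≈lam {t = t} {t'} p) {γ} e =
      ≈trans (sub-≈ (reifyᵛ γ) (≈lam p)) (sub-cong-≈ (λ x → reify-Equal _ (e x)) (lam t')) ,
      (λ q → eval-≈ p (▸-≋ e q)) ,
      Equal-coherent (eval-Equal (lam t) (≋-reflˡ e))
    eval-≈ (≈app p q)     e = Equal-app (eval-≈ p e) (eval-≈ q e)

    idᵛ : Valuation Θ
    idᵛ x = reflect _ (var x)

    idᵛ-≋ : idᵛ ≋ idᵛ
    idᵛ-≋ x = reflect-Equal _ ≈refl

    reify-eval-idᵛ : ∀ {τ} (t : Tm Θ τ) → t ≈ reify τ (eval t idᵛ)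
    reify-eval-idᵛ t =
      ≈sym (≈trans (eval-reify t idᵛ-≋)
                   (≡⇒≈ (trans (sub-cong (λ x → reify-reflect _ (var x)) t) (sub-id t))))

    sc-injective : {a b : Tm Θ nt} → app sc a ≈ app sc b → a ≈ b
    sc-injective {a} {b} p with eval-≈ p idᵛ-≋
    ... | suc q = ≈trans (reify-eval-idᵛ a) (≈trans (reify-Equal nt q) (≈sym (reify-eval-idᵛ b)))

    zc≉sc : {a : Tm Θ nt} → ¬ (zc ≈ app sc a)
    zc≉sc p with eval-≈ p idᵛ-≋
    ... | ()

  open Glued using (sc-injective; zc≉sc)

  -- Derived sequent rules

  castʳ : ∀ {Δ Γ} {A B : Fm Δ} → A ≡ B → Δ ⨾ Γ ⟶ A → Δ ⨾ Γ ⟶ B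
  castʳ refl d = d

  castˡ : ∀ {Δ Γ C} {A B : Fm Δ} → A ≡ B → Δ ⨾ A ∷ Γ ⟶ C → Δ ⨾ B ∷ Γ ⟶ C
  castˡ refl d = d

  convʳ : ∀ {Δ Γ} {A B : Fm Δ} → A ≈F B → Δ ⨾ Γ ⟶ A → Δ ⨾ Γ ⟶ B
  convʳ = conv (PW.refl λ {A} → reflF A)

  identity : ∀ {Δ Γ} (A : Fm Δ) → Δ ⨾ A ∷ Γ ⟶ A
  identity (natᶠ t)    = init at-nat
  identity (eqᶠ t u)   = init at-eq
  identity (pred p ts) = init at-pred
  identity ⊥ᶠ          = ⊥L
  identity ⊤ᶠ          = ⊤R
  identity (A ∧ᶠ B)    = ∧R (∧L₁ (identity A)) (∧L₂ (identity B))
  identity (A ∨ᶠ B)    = ∨L (∨R₁ (identity A)) (∨R₂ (identity B))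
  identity (A ⊃ᶠ B)    = ⊃R (exch (↭-swap _ _ ↭-refl) (⊃L (identity A) (identity B)))
  identity (∀ᶠ τ A)    = ∀R (∀L (var here) (castˡ (sym (subF-σ₀-var A)) (identity A)))
  identity (∃ᶠ τ A)    = ∃L (∃R (var here) (castʳ (sym (subF-σ₀-var A)) (identity A)))

  hyp : ∀ {Δ Γ} {A : Fm Δ} → A ∈ Γ → Δ ⨾ Γ ⟶ A
  hyp {A = A} A∈Γ with Γ₁ , Γ₂ , refl ← ∈-∃++ A∈Γ = exch (↭-sym (shift A Γ₁ Γ₂)) (identity A)

  hyp₀ : ∀ {Δ Γ} {A : Fm Δ} → Δ ⨾ A ∷ Γ ⟶ A
  hyp₀ = hyp (here refl)

  hyp₁ : ∀ {Δ Γ} {A B : Fm Δ} → Δ ⨾ B ∷ A ∷ Γ ⟶ A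
  hyp₁ = hyp (there (here refl))

  hyp₂ : ∀ {Δ Γ} {A B C : Fm Δ} → Δ ⨾ C ∷ B ∷ A ∷ Γ ⟶ A
  hyp₂ = hyp (there (there (here refl)))

  ⊃E : ∀ {Δ Γ} {A B : Fm Δ} → Δ ⨾ Γ ⟶ A ⊃ᶠ B → Δ ⨾ Γ ⟶ A → Δ ⨾ Γ ⟶ B
  ⊃E {B = B} p q = cut p (⊃L q (identity B))

  ∧E₁ : ∀ {Δ Γ} {A B : Fm Δ} → Δ ⨾ Γ ⟶ A ∧ᶠ B → Δ ⨾ Γ ⟶ A
  ∧E₁ {A = A} p = cut p (∧L₁ (identity A))

  ∧E₂ : ∀ {Δ Γ} {A B : Fm Δ} → Δ ⨾ Γ ⟶ A ∧ᶠ B → Δ ⨾ Γ ⟶ B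
  ∧E₂ {B = B} p = cut p (∧L₂ (identity B))

  ∀E : ∀ {Δ Γ τ} {A : Fm (τ ∷ Δ)} (t : Tm Δ τ) → Δ ⨾ Γ ⟶ ∀ᶠ τ A → Δ ⨾ Γ ⟶ subF (σ₀ t) A
  ∀E t p = cut p (∀L t (identity _))

  ∀E-var : ∀ {Δ τ Γ} {A : Fm (τ ∷ Δ)} → (τ ∷ Δ) ⨾ Γ ⟶ wkF (∀ᶠ τ A) → (τ ∷ Δ) ⨾ Γ ⟶ A
  ∀E-var {A = A} p = castʳ (subF-σ₀-var A) (∀E (var here) p)

  -- The set of all unifiers is trivially complete, each unifier being an instance of itself.
  eqL : ∀ {Δ Γ C} {u₁ u₂ : Tm Δ nt} →
        (∀ {Δ'} (θ : Sub Δ Δ') → sub θ u₁ ≈ sub θ u₂ → Δ' ⨾ ⊤ᶠ ∷ map (subF θ) Γ ⟶ subF θ C) →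
        Δ ⨾ eqᶠ u₁ u₂ ∷ Γ ⟶ C
  eqL {u₁ = u₁} {u₂} k =
    defL (Unifier u₁ u₂) ((λ θ p → p) , λ σ p → _ , σ , p , var , λ x → ≡⇒≈ (sym (sub-id (σ x))))
      λ θ (p , q) → k (restr θ) (≈trans (≡⇒≈ (sym (sub-ren θ there u₁)))
                                  (≈trans p (≈trans (≈sym q) (≡⇒≈ (sub-ren θ there u₂)))))

  eq-consequence : ∀ {Δ Γ} {a b c d : Tm Δ nt} →
                   (∀ {Δ'} (θ : Sub Δ Δ') → sub θ a ≈ sub θ b → sub θ c ≈ sub θ d) →
                   Δ ⨾ Γ ⟶ eqᶠ a b → Δ ⨾ Γ ⟶ eqᶠ c d
  eq-consequence k p = cut p (eqL λ θ e → convʳ (c-eq ≈refl (k θ e)) (defR ⊤R))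

  eq-sym : ∀ {Δ Γ} {a b : Tm Δ nt} → Δ ⨾ Γ ⟶ eqᶠ a b → Δ ⨾ Γ ⟶ eqᶠ b a
  eq-sym = eq-consequence λ θ e → ≈sym e

  eq-cong-sc : ∀ {Δ Γ} {a b : Tm Δ nt} → Δ ⨾ Γ ⟶ eqᶠ a b → Δ ⨾ Γ ⟶ eqᶠ (app sc a) (app sc b)
  eq-cong-sc = eq-consequence λ θ e → ≈app ≈refl e

  eq-sc-injective : ∀ {Δ Γ} {a b : Tm Δ nt} → Δ ⨾ Γ ⟶ eqᶠ (app sc a) (app sc b) → Δ ⨾ Γ ⟶ eqᶠ a b
  eq-sc-injective = eq-consequence λ θ e → sc-injective _ e

  eq-trans : ∀ {Δ Γ} {a b c : Tm Δ nt} → Δ ⨾ Γ ⟶ eqᶠ a b → Δ ⨾ Γ ⟶ eqᶠ b c → Δ ⨾ Γ ⟶ eqᶠ a c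
  eq-trans p q = ⊃E (⊃E (⊃R (⊃R (eqL λ θ e → convʳ (c-eq ≈refl e) hyp₁))) p) q

  zc≡sc-elim : ∀ {Δ Γ C} {a : Tm Δ nt} → Δ ⨾ Γ ⟶ eqᶠ zc (app sc a) → Δ ⨾ Γ ⟶ C
  zc≡sc-elim p = cut p (eqL λ θ e → ⊥-elim (zc≉sc _ e))

  -- Translation and substitution

  ≡ᵇ-refl : ∀ n → (n ≡ᵇ n) ≡ true
  ≡ᵇ-refl zero    = refl
  ≡ᵇ-refl (suc n) = ≡ᵇ-refl n

  ≢⇒≡ᵇ≡false : ∀ {m n} → m ≢ n → (m ≡ᵇ n) ≡ false
  ≢⇒≡ᵇ≡false {zero}  {zero}  m≢n = ⊥-elim (m≢n refl)
  ≢⇒≡ᵇ≡false {zero}  {suc n} m≢n = refl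
  ≢⇒≡ᵇ≡false {suc m} {zero}  m≢n = refl
  ≢⇒≡ᵇ≡false {suc m} {suc n} m≢n = ≢⇒≡ᵇ≡false (λ m≡n → m≢n (cong suc m≡n))

  extEnv-here : ∀ {Δ} (ρ : Env Δ) x → extEnv ρ x x ≡ var here
  extEnv-here ρ x rewrite ≡ᵇ-refl x = refl

  extEnv-there : ∀ {Δ} (ρ : Env Δ) {x y} → x ≢ y → extEnv ρ x y ≡ ren there (ρ y)
  extEnv-there ρ x≢y rewrite ≢⇒≡ᵇ≡false x≢y = refl

  infixl 6 _[_↦_]
  _[_↦_] : ∀ {Δ} → Env Δ → ℕ → Tm Δ nt → Env Δ
  (ρ [ x ↦ u ]) y = if x ≡ᵇ y then u else ρ y

  update-here : ∀ {Δ} (ρ : Env Δ) x u → (ρ [ x ↦ u ]) x ≡ u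
  update-here ρ x u rewrite ≡ᵇ-refl x = refl

  update-there : ∀ {Δ} (ρ : Env Δ) {x y} u → x ≢ y → (ρ [ x ↦ u ]) y ≡ ρ y
  update-there ρ u x≢y rewrite ≢⇒≡ᵇ≡false x≢y = refl

  ∀ℕ ∃ℕ : ∀ {Δ} → Fm (nt ∷ Δ) → Fm Δ
  ∀ℕ B = ∀ᶠ nt (natᶠ (var here) ⊃ᶠ B)
  ∃ℕ B = ∃ᶠ nt (natᶠ (var here) ∧ᶠ B)

  transT-cong : ∀ {Δ} {ρ ρ' : Env Δ} (t : ITm) → (∀ y → y ∈ₜ t → ρ y ≡ ρ' y) →
                transT ρ t ≡ transT ρ' t
  transT-cong (ivar x) h = h x here
  transT-cong iz       h = refl
  transT-cong (is t)   h = cong (app sc) (transT-cong t (λ y p → h y (ins p)))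

  extEnv-cong : ∀ {Δ} {ρ ρ' : Env Δ} x {P : ℕ → Set} → (∀ y → x ≢ y → P y → ρ y ≡ ρ' y) →
                ∀ y → P y → extEnv ρ x y ≡ extEnv ρ' x y
  extEnv-cong {ρ = ρ} {ρ'} x h y p with x ≟ y
  ... | yes refl = trans (extEnv-here ρ x) (sym (extEnv-here ρ' x))
  ... | no x≢y   = trans (extEnv-there ρ x≢y)
                         (trans (cong (ren there) (h y x≢y p)) (sym (extEnv-there ρ' x≢y)))

  transF-cong : ∀ {Δ} {ρ ρ' : Env Δ} (A : IFm) → (∀ y → y ∈ᶠᵛ A → ρ y ≡ ρ' y) →
                transF ρ A ≡ transF ρ' A
  transF-cong (a ≐ b)  h = cong₂ eqᶠ (transT-cong a (λ y p → h y (eqˡ p)))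
                                     (transT-cong b (λ y p → h y (eqʳ p)))
  transF-cong ⊥ⁱ       h = refl
  transF-cong ⊤ⁱ       h = refl
  transF-cong (A ∧ⁱ B) h = cong₂ _∧ᶠ_ (transF-cong A (λ y p → h y (∧ˡ p))) (transF-cong B (λ y p → h y (∧ʳ p)))
  transF-cong (A ∨ⁱ B) h = cong₂ _∨ᶠ_ (transF-cong A (λ y p → h y (∨ˡ p))) (transF-cong B (λ y p → h y (∨ʳ p)))
  transF-cong (A ⊃ⁱ B) h = cong₂ _⊃ᶠ_ (transF-cong A (λ y p → h y (⊃ˡ p))) (transF-cong B (λ y p → h y (⊃ʳ p)))
  transF-cong (∀ⁱ x A) h = cong ∀ℕ (transF-cong A (extEnv-cong x λ y x≢y p → h y (∀∈ (≢-sym x≢y) p)))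
  transF-cong (∃ⁱ x A) h = cong ∃ℕ (transF-cong A (extEnv-cong x λ y x≢y p → h y (∃∈ (≢-sym x≢y) p)))

  transF-cong-≗ : ∀ {Δ} {ρ ρ' : Env Δ} (A : IFm) → (∀ y → ρ y ≡ ρ' y) → transF ρ A ≡ transF ρ' A
  transF-cong-≗ A h = transF-cong A (λ y _ → h y)

  sub-transT : ∀ {Δ Δ'} (s : Sub Δ Δ') (ρ : Env Δ) (t : ITm) →
               sub s (transT ρ t) ≡ transT (λ y → sub s (ρ y)) t
  sub-transT s ρ (ivar x) = refl
  sub-transT s ρ iz       = refl
  sub-transT s ρ (is t)   = cong (app sc) (sub-transT s ρ t)

  sub-extEnv : ∀ {Δ Δ'} (s : Sub Δ Δ') (ρ : Env Δ) x y →
               sub (exts s) (extEnv ρ x y) ≡ extEnv (λ y → sub s (ρ y)) x y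
  sub-extEnv s ρ x y with x ≟ y
  ... | yes refl = trans (cong (sub (exts s)) (extEnv-here ρ x)) (sym (extEnv-here (λ y → sub s (ρ y)) x))
  ... | no x≢y   = trans (cong (sub (exts s)) (extEnv-there ρ x≢y))
                         (trans (sub-exts-wk s (ρ y)) (sym (extEnv-there (λ y → sub s (ρ y)) x≢y)))

  subF-transF : ∀ {Δ Δ'} (s : Sub Δ Δ') (ρ : Env Δ) (A : IFm) →
                subF s (transF ρ A) ≡ transF (λ y → sub s (ρ y)) A
  subF-transF s ρ (a ≐ b)  = cong₂ eqᶠ (sub-transT s ρ a) (sub-transT s ρ b)
  subF-transF s ρ ⊥ⁱ       = refl
  subF-transF s ρ ⊤ⁱ       = refl
  subF-transF s ρ (A ∧ⁱ B) = cong₂ _∧ᶠ_ (subF-transF s ρ A) (subF-transF s ρ B)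
  subF-transF s ρ (A ∨ⁱ B) = cong₂ _∨ᶠ_ (subF-transF s ρ A) (subF-transF s ρ B)
  subF-transF s ρ (A ⊃ⁱ B) = cong₂ _⊃ᶠ_ (subF-transF s ρ A) (subF-transF s ρ B)
  subF-transF s ρ (∀ⁱ x A) =
    cong ∀ℕ (trans (subF-transF (exts s) (extEnv ρ x) A) (transF-cong-≗ A (sub-extEnv s ρ x)))
  subF-transF s ρ (∃ⁱ x A) =
    cong ∃ℕ (trans (subF-transF (exts s) (extEnv ρ x) A) (transF-cong-≗ A (sub-extEnv s ρ x)))

  wkF-transF : ∀ {Δ} (ρ : Env Δ) x (B : IFm) → ¬ (x ∈ᶠᵛ B) →
               wkF (transF ρ B) ≡ transF (extEnv ρ x) B
  wkF-transF ρ x B x∉B =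
    trans (renF≡subF there _) (trans (subF-transF _ ρ B)
      (transF-cong B λ y p → trans (sym (ren≡sub there (ρ y)))
                                   (sym (extEnv-there ρ {x} {y} λ { refl → x∉B p }))))

  subF-σ₀-transF : ∀ {Δ} (ρ : Env Δ) x u (A : IFm) →
                   subF (σ₀ u) (transF (extEnv ρ x) A) ≡ transF (ρ [ x ↦ u ]) A
  subF-σ₀-transF ρ x u A = trans (subF-transF _ _ A) (transF-cong-≗ A σ₀-extEnv)
    where
      σ₀-extEnv : ∀ y → sub (σ₀ u) (extEnv ρ x y) ≡ (ρ [ x ↦ u ]) y
      σ₀-extEnv y with x ≟ y
      ... | yes refl = trans (cong (sub (σ₀ u)) (extEnv-here ρ x)) (sym (update-here ρ x u))
      ... | no x≢y   = trans (cong (sub (σ₀ u)) (extEnv-there ρ x≢y))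
                             (trans (sub-σ₀-wk u (ρ y)) (sym (update-there ρ u x≢y)))

  transT-substT : ∀ {Δ} (ρ : Env Δ) t x (a : ITm) →
                  transT ρ (substT t x a) ≡ transT (ρ [ x ↦ transT ρ t ]) a
  transT-substT ρ t x (ivar y) with x ≟ y
  ... | yes refl rewrite ≡ᵇ-refl x = refl
  ... | no x≢y   rewrite ≢⇒≡ᵇ≡false x≢y = refl
  transT-substT ρ t x iz     = refl
  transT-substT ρ t x (is a) = cong (app sc) (transT-substT ρ t x a)

  transF-update-fresh : ∀ {Δ} (ρ : Env Δ) x u (A : IFm) → ¬ (x ∈ᶠᵛ A) →
                        transF (ρ [ x ↦ u ]) A ≡ transF ρ A
  transF-update-fresh ρ x u A x∉A = transF-cong A λ y p → update-there ρ {x} {y} u λ { refl → x∉A p }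

  substT-fresh : ∀ t x (a : ITm) → ¬ (x ∈ₜ a) → substT t x a ≡ a
  substT-fresh t x (ivar y) x∉a with x ≟ y
  ... | yes refl = ⊥-elim (x∉a here)
  ... | no x≢y   rewrite ≢⇒≡ᵇ≡false x≢y = refl
  substT-fresh t x iz     x∉a = refl
  substT-fresh t x (is a) x∉a = cong is (substT-fresh t x a (λ p → x∉a (ins p)))

  substF-fresh : ∀ t x (A : IFm) → ¬ (x ∈ᶠᵛ A) → substF t x A ≡ A
  substF-fresh t x (a ≐ b) x∉A =
    cong₂ _≐_ (substT-fresh t x a (λ p → x∉A (eqˡ p))) (substT-fresh t x b (λ p → x∉A (eqʳ p)))
  substF-fresh t x ⊥ⁱ       x∉A = refl
  substF-fresh t x ⊤ⁱ       x∉A = refl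
  substF-fresh t x (A ∧ⁱ B) x∉A =
    cong₂ _∧ⁱ_ (substF-fresh t x A (λ p → x∉A (∧ˡ p))) (substF-fresh t x B (λ p → x∉A (∧ʳ p)))
  substF-fresh t x (A ∨ⁱ B) x∉A =
    cong₂ _∨ⁱ_ (substF-fresh t x A (λ p → x∉A (∨ˡ p))) (substF-fresh t x B (λ p → x∉A (∨ʳ p)))
  substF-fresh t x (A ⊃ⁱ B) x∉A =
    cong₂ _⊃ⁱ_ (substF-fresh t x A (λ p → x∉A (⊃ˡ p))) (substF-fresh t x B (λ p → x∉A (⊃ʳ p)))
  substF-fresh t x (∀ⁱ y A) x∉A with x ≟ y
  ... | yes refl rewrite ≡ᵇ-refl x = refl
  ... | no x≢y   rewrite ≢⇒≡ᵇ≡false x≢y = cong (∀ⁱ y) (substF-fresh t x A (λ p → x∉A (∀∈ x≢y p)))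
  substF-fresh t x (∃ⁱ y A) x∉A with x ≟ y
  ... | yes refl rewrite ≡ᵇ-refl x = refl
  ... | no x≢y   rewrite ≢⇒≡ᵇ≡false x≢y = cong (∃ⁱ y) (substF-fresh t x A (λ p → x∉A (∃∈ x≢y p)))

  transT-extEnv-fresh : ∀ {Δ} (ρ : Env Δ) y (t : ITm) → ¬ (y ∈ₜ t) →
                        transT (extEnv ρ y) t ≡ ren there (transT ρ t)
  transT-extEnv-fresh ρ y (ivar x) y∉t with y ≟ x
  ... | yes refl = ⊥-elim (y∉t here)
  ... | no y≢x   = extEnv-there ρ y≢x
  transT-extEnv-fresh ρ y iz     y∉t = refl
  transT-extEnv-fresh ρ y (is t) y∉t = cong (app sc) (transT-extEnv-fresh ρ y t (λ p → y∉t (ins p)))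

  update-extEnv : ∀ {Δ} (ρ : Env Δ) {x y} u → x ≢ y →
                  ∀ w → (extEnv ρ y [ x ↦ ren there u ]) w ≡ extEnv (ρ [ x ↦ u ]) y w
  update-extEnv ρ {x} {y} u x≢y w with x ≟ w | y ≟ w
  ... | yes refl | _ = trans (update-here (extEnv ρ y) x _)
                         (trans (cong (ren there) (sym (update-here ρ x u)))
                                (sym (extEnv-there (ρ [ x ↦ u ]) (≢-sym x≢y))))
  ... | no x≢w | yes refl = trans (update-there (extEnv ρ y) _ x≢w)
                              (trans (extEnv-here ρ y) (sym (extEnv-here (ρ [ x ↦ u ]) y)))
  ... | no x≢w | no y≢w   = trans (update-there (extEnv ρ y) _ x≢w)
                              (trans (extEnv-there ρ y≢w)
                                (trans (cong (ren there) (sym (update-there ρ u x≢w)))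
                                       (sym (extEnv-there (ρ [ x ↦ u ]) y≢w))))

  -- the bound variable y is not captured since y ∉ t
  binder-step : ∀ {Δ} (ρ : Env Δ) t {x y} (A : IFm) → FreeFor t x A → ¬ (y ∈ₜ t) → x ≢ y →
                transF (extEnv ρ y) (substF t x A) ≡ transF (extEnv (ρ [ x ↦ transT ρ t ]) y) A

  transF-substF : ∀ {Δ} (ρ : Env Δ) t x (A : IFm) → FreeFor t x A →
                  transF ρ (substF t x A) ≡ transF (ρ [ x ↦ transT ρ t ]) A
  transF-substF ρ t x (a ≐ b)  ff          = cong₂ eqᶠ (transT-substT ρ t x a) (transT-substT ρ t x b)
  transF-substF ρ t x ⊥ⁱ       ff          = refl
  transF-substF ρ t x ⊤ⁱ       ff          = refl
  transF-substF ρ t x (A ∧ⁱ B) (ff∧ fA fB) = cong₂ _∧ᶠ_ (transF-substF ρ t x A fA) (transF-substF ρ t x B fB)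
  transF-substF ρ t x (A ∨ⁱ B) (ff∨ fA fB) = cong₂ _∨ᶠ_ (transF-substF ρ t x A fA) (transF-substF ρ t x B fB)
  transF-substF ρ t x (A ⊃ⁱ B) (ff⊃ fA fB) = cong₂ _⊃ᶠ_ (transF-substF ρ t x A fA) (transF-substF ρ t x B fB)
  transF-substF ρ t x (∀ⁱ y A) (ff∀₀ x∉A)  =
    trans (cong (transF ρ) (substF-fresh t x _ x∉A)) (sym (transF-update-fresh ρ x _ _ x∉A))
  transF-substF ρ t x (∀ⁱ y A) (ff∀ y∉t f) with x ≟ y
  ... | yes refl rewrite ≡ᵇ-refl x =
    sym (transF-update-fresh ρ x _ (∀ⁱ x A) λ { (∀∈ x≢x _) → x≢x refl })
  ... | no x≢y rewrite ≢⇒≡ᵇ≡false x≢y =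
    cong ∀ℕ (binder-step ρ t A f y∉t x≢y)
  transF-substF ρ t x (∃ⁱ y A) (ff∃₀ x∉A)  =
    trans (cong (transF ρ) (substF-fresh t x _ x∉A)) (sym (transF-update-fresh ρ x _ _ x∉A))
  transF-substF ρ t x (∃ⁱ y A) (ff∃ y∉t f) with x ≟ y
  ... | yes refl rewrite ≡ᵇ-refl x =
    sym (transF-update-fresh ρ x _ (∃ⁱ x A) λ { (∃∈ x≢x _) → x≢x refl })
  ... | no x≢y rewrite ≢⇒≡ᵇ≡false x≢y =
    cong ∃ℕ (binder-step ρ t A f y∉t x≢y)

  binder-step ρ t {x} {y} A f y∉t x≢y =
    trans (transF-substF (extEnv ρ y) t x A f)
          (trans (cong (λ u → transF (extEnv ρ y [ x ↦ u ]) A) (transT-extEnv-fresh ρ y t y∉t))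
                 (transF-cong-≗ A (update-extEnv ρ (transT ρ t) x≢y)))

  freeFor-iz : ∀ x (φ : IFm) → FreeFor iz x φ
  freeFor-iz x (a ≐ b)  = ff≐
  freeFor-iz x ⊥ⁱ       = ff⊥
  freeFor-iz x ⊤ⁱ       = ff⊤
  freeFor-iz x (A ∧ⁱ B) = ff∧ (freeFor-iz x A) (freeFor-iz x B)
  freeFor-iz x (A ∨ⁱ B) = ff∨ (freeFor-iz x A) (freeFor-iz x B)
  freeFor-iz x (A ⊃ⁱ B) = ff⊃ (freeFor-iz x A) (freeFor-iz x B)
  freeFor-iz x (∀ⁱ y A) = ff∀ (λ ()) (freeFor-iz x A)
  freeFor-iz x (∃ⁱ y A) = ff∃ (λ ()) (freeFor-iz x A)

  freeFor-is-self : ∀ x (φ : IFm) → FreeFor (is (v x)) x φ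
  freeFor-is-self x (a ≐ b)  = ff≐
  freeFor-is-self x ⊥ⁱ       = ff⊥
  freeFor-is-self x ⊤ⁱ       = ff⊤
  freeFor-is-self x (A ∧ⁱ B) = ff∧ (freeFor-is-self x A) (freeFor-is-self x B)
  freeFor-is-self x (A ∨ⁱ B) = ff∨ (freeFor-is-self x A) (freeFor-is-self x B)
  freeFor-is-self x (A ⊃ⁱ B) = ff⊃ (freeFor-is-self x A) (freeFor-is-self x B)
  freeFor-is-self x (∀ⁱ y A) with x ≟ y
  ... | yes refl = ff∀₀ λ { (∀∈ x≢x _) → x≢x refl }
  ... | no x≢y   = ff∀ (λ { (ins here) → x≢y refl }) (freeFor-is-self x A)
  freeFor-is-self x (∃ⁱ y A) with x ≟ y
  ... | yes refl = ff∃₀ λ { (∃∈ x≢x _) → x≢x refl }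
  ... | no x≢y   = ff∃ (λ { (ins here) → x≢y refl }) (freeFor-is-self x A)

  -- Soundness of the translation

  NatValued : ∀ {Δ} → List (Fm Δ) → Env Δ → Set
  NatValued Γ ρ = ∀ y → natᶠ (ρ y) ∈ Γ

  Valid : IFm → Set₁
  Valid A = ∀ {Δ} (ρ : Env Δ) (Γ : List (Fm Δ)) → NatValued Γ ρ → Δ ⨾ Γ ⟶ transF ρ A

  NatValued-∷ : ∀ {Δ Γ} {ρ : Env Δ} {A} → NatValued Γ ρ → NatValued (A ∷ Γ) ρ
  NatValued-∷ n y = there (n y)

  NatValued-extEnv : ∀ {Δ Γ} {ρ : Env Δ} → NatValued Γ ρ → ∀ x →
                     NatValued (natᶠ (var here) ∷ wkΓ Γ) (extEnv ρ x)
  NatValued-extEnv {ρ = ρ} n x y with x ≟ y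
  ... | yes refl = subst (λ t → natᶠ t ∈ _) (sym (extEnv-here ρ x)) (here refl)
  ... | no x≢y   = subst (λ t → natᶠ t ∈ _) (sym (extEnv-there ρ x≢y)) (there (∈-map⁺ (renF there) (n y)))

  nat-transT : ∀ {Δ Γ} {ρ : Env Δ} → NatValued Γ ρ → (t : ITm) → Δ ⨾ Γ ⟶ natᶠ (transT ρ t)
  nat-transT n (ivar x) = hyp (n x)
  nat-transT n iz       = natZ
  nat-transT n (is t)   = natS (nat-transT n t)

  -- natI only has closed premises, so the induction formula B carries the hypothesis H
  -- along; its conjunct nat j is what makes the step hypothesis applicable.
  induction-rule : ∀ {Δ Γ} (P : Fm (nt ∷ Δ)) →
                   Δ ⨾ Γ ⟶ (subF (σ₀ zc) P ∧ᶠ ∀ℕ (P ⊃ᶠ subF sj P)) ⊃ᶠ ∀ℕ P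
  induction-rule {Δ} P = ⊃R (∀R (⊃R (natI B base-case step-case (castˡ (sym B-at-var) (∧E₂ (⊃E hyp₀ hyp₁))))))
    where
      H : Fm Δ
      H = subF (σ₀ zc) P ∧ᶠ ∀ℕ (P ⊃ᶠ subF sj P)

      B : Fm (nt ∷ nt ∷ Δ)
      B = wkF (wkF H) ⊃ᶠ (natᶠ (var here) ∧ᶠ renF (ext there) P)

      B-at-var : subF (σ₀ (var here)) B ≡ (wkF H ⊃ᶠ (natᶠ (var here) ∧ᶠ P))
      B-at-var = cong₂ _⊃ᶠ_ (subF-σ₀-wk (var here) (wkF H)) (cong (natᶠ (var here) ∧ᶠ_) (subF-σ₀-var P))

      P-at-zc : subF (σ₀ zc) (renF (ext there) P) ≡ wkF (subF (σ₀ zc) P)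
      P-at-zc = trans (subF-renF _ _ P)
                      (trans (subF-cong (λ { here → refl ; (there x) → refl }) P) (sym (renF-subF there _ P)))

      H-at-sj : subF sj (wkF (wkF H)) ≡ wkF (wkF H)
      H-at-sj = trans (subF-renF sj there (wkF H)) (sym (renF≡subF there (wkF H)))

      P-at-sj : subF sj (renF (ext there) P) ≡ renF (ext there) (subF sj P)
      P-at-sj = trans (subF-renF _ _ P)
                      (trans (subF-cong (λ { here → refl ; (there x) → refl }) P)
                             (sym (renF-subF (ext there) sj P)))

      base-case : (nt ∷ Δ) ⨾ [] ⟶ subF (σ₀ zc) B
      base-case = castʳ (sym (cong₂ _⊃ᶠ_ (subF-σ₀-wk zc (wkF H)) (cong (natᶠ zc ∧ᶠ_) P-at-zc)))
                   (⊃R (∧R natZ (∧E₁ hyp₀)))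

      step-case : (nt ∷ nt ∷ Δ) ⨾ B ∷ [] ⟶ subF sj B
      step-case = castʳ (sym (cong₂ _⊃ᶠ_ H-at-sj (cong (natᶠ (app sc (var here)) ∧ᶠ_) P-at-sj)))
                   (⊃R (∧R (natS nat-j)
                           (⊃E (⊃E (∀E-var {A = renF (ext there) (natᶠ (var here) ⊃ᶠ P ⊃ᶠ subF sj P)}
                                           (∧E₂ hyp₀))
                                   nat-j)
                               (∧E₂ (⊃E hyp₁ hyp₀)))))
        where nat-j = ∧E₁ (⊃E hyp₁ hyp₀)

  update-sj : ∀ {Δ} (ρ : Env Δ) x w →
              (extEnv ρ x [ x ↦ app sc (extEnv ρ x x) ]) w ≡ sub sj (extEnv ρ x w)
  update-sj ρ x w with x ≟ w
  ... | yes refl = trans (update-here (extEnv ρ x) x _)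
                         (trans (cong (app sc) (extEnv-here ρ x)) (sym (cong (sub sj) (extEnv-here ρ x))))
  ... | no x≢w   = trans (update-there (extEnv ρ x) _ x≢w)
                         (trans (extEnv-there ρ x≢w)
                                (sym (trans (cong (sub sj) (extEnv-there ρ x≢w))
                                            (trans (sub-ren sj there (ρ w)) (sym (ren≡sub there (ρ w)))))))

  ∀E-axiom-valid : ∀ {t x A} → FreeFor t x A → Valid (∀ⁱ x A ⊃ⁱ substF t x A)
  ∀E-axiom-valid {t} {x} {A} ff ρ Γ n =
    ⊃R (castʳ (sym (transF-substF ρ t x A ff))
              (⊃E (castʳ (cong (natᶠ (transT ρ t) ⊃ᶠ_) (subF-σ₀-transF ρ x (transT ρ t) A))
                         (∀E (transT ρ t) hyp₀))
                  (nat-transT (NatValued-∷ n) t)))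

  ∃I-axiom-valid : ∀ {t x A} → FreeFor t x A → Valid (substF t x A ⊃ⁱ ∃ⁱ x A)
  ∃I-axiom-valid {t} {x} {A} ff ρ Γ n =
    ⊃R (∃R (transT ρ t) (∧R (nat-transT (NatValued-∷ n) t)
                            (castʳ (trans (transF-substF ρ t x A ff) (sym (subF-σ₀-transF ρ x (transT ρ t) A)))
                                   hyp₀)))

  induction-axiom-valid : ∀ {φ x} → Valid (substF iz x φ ∧ⁱ ∀ⁱ x (φ ⊃ⁱ substF (is (v x)) x φ) ⊃ⁱ ∀ⁱ x φ)
  induction-axiom-valid {φ} {x} ρ Γ n =
    castʳ (cong₂ (λ Pz Ps → (Pz ∧ᶠ ∀ℕ (P ⊃ᶠ Ps)) ⊃ᶠ ∀ℕ P) (sym P-at-zc) (sym P-at-sc)) (induction-rule P)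
    where
      P = transF (extEnv ρ x) φ
      P-at-zc : transF ρ (substF iz x φ) ≡ subF (σ₀ zc) P
      P-at-zc = trans (transF-substF ρ iz x φ (freeFor-iz x φ)) (sym (subF-σ₀-transF ρ x zc φ))
      P-at-sc : transF (extEnv ρ x) (substF (is (v x)) x φ) ≡ subF sj P
      P-at-sc = trans (transF-substF (extEnv ρ x) (is (v x)) x φ (freeFor-is-self x φ))
                      (trans (transF-cong-≗ φ (update-sj ρ x)) (sym (subF-transF sj (extEnv ρ x) φ)))

  axiom-valid : ∀ {A} → IAx A → Valid A
  axiom-valid axK   ρ Γ n = ⊃R (⊃R hyp₁)
  axiom-valid axS   ρ Γ n = ⊃R (⊃R (⊃R (⊃E (⊃E hyp₂ hyp₀) (⊃E hyp₁ hyp₀))))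
  axiom-valid ax∧E₁ ρ Γ n = ⊃R (∧E₁ hyp₀)
  axiom-valid ax∧E₂ ρ Γ n = ⊃R (∧E₂ hyp₀)
  axiom-valid ax∧I  ρ Γ n = ⊃R (⊃R (∧R hyp₁ hyp₀))
  axiom-valid ax∨I₁ ρ Γ n = ⊃R (∨R₁ hyp₀)
  axiom-valid ax∨I₂ ρ Γ n = ⊃R (∨R₂ hyp₀)
  axiom-valid ax∨E  ρ Γ n = ⊃R (⊃R (⊃R (∨L (⊃E hyp₂ hyp₀) (⊃E hyp₁ hyp₀))))
  axiom-valid ax⊥E  ρ Γ n = ⊃R ⊥L
  axiom-valid ax⊤I  ρ Γ n = ⊤R
  axiom-valid (ax∀E ff) = ∀E-axiom-valid ff
  axiom-valid (ax∃I ff) = ∃I-axiom-valid ff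
  axiom-valid (ax∀I {x = x} {B = B} x∉B) ρ Γ n =
    ⊃R (⊃R (∀R (⊃R (⊃E (⊃E (∀E-var hyp₂) hyp₀) (castʳ (wkF-transF ρ x B x∉B) hyp₁)))))
  axiom-valid (ax∃E {x = x} {B = B} x∉B) ρ Γ n =
    ⊃R (⊃R (∃L (castʳ (sym (wkF-transF ρ x B x∉B)) (⊃E (⊃E (∀E-var hyp₁) (∧E₁ hyp₀)) (∧E₂ hyp₀)))))
  axiom-valid axRefl  ρ Γ n = ∀R (⊃R (defR ⊤R))
  axiom-valid axSym   ρ Γ n = ∀R (⊃R (∀R (⊃R (⊃R (eq-sym hyp₀)))))
  axiom-valid axTrans ρ Γ n = ∀R (⊃R (∀R (⊃R (∀R (⊃R (⊃R (⊃R (eq-trans hyp₁ hyp₀))))))))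
  axiom-valid axSubS  ρ Γ n = ∀R (⊃R (∀R (⊃R (⊃R (eq-cong-sc hyp₀)))))
  axiom-valid axSubEq ρ Γ n =
    ∀R (⊃R (∀R (⊃R (∀R (⊃R (∀R (⊃R (⊃R (⊃R (⊃R (eq-trans (eq-trans (eq-sym hyp₂) hyp₀) hyp₁)))))))))))
  axiom-valid axInj   ρ Γ n = ∀R (⊃R (∀R (⊃R (⊃R (eq-sc-injective hyp₀)))))
  axiom-valid axZS    ρ Γ n = ∀R (⊃R (⊃R (zc≡sc-elim hyp₀)))
  axiom-valid (axInd _) = induction-axiom-valid

  follows-valid : ∀ {Φ C} → All Valid Φ → Follows Φ C → Valid C
  follows-valid valid (inj₁ ax) = axiom-valid ax
  follows-valid valid (inj₂ (inj₁ (B , B∈Φ , B⊃C∈Φ))) ρ Γ n =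
    ⊃E (All.lookup valid B⊃C∈Φ ρ Γ n) (All.lookup valid B∈Φ ρ Γ n)
  follows-valid valid (inj₂ (inj₂ (x , B , refl , B∈Φ))) ρ Γ n =
    ∀R (⊃R (All.lookup valid B∈Φ (extEnv ρ x) _ (NatValued-extEnv n x)))

  derivation-valid : ∀ {Φ} → HList Φ → All Valid Φ
  derivation-valid nil        = []
  derivation-valid (snoc h f) = follows-valid (derivation-valid h) f ∷ derivation-valid h

  ⊢ipa⇒derivable : ∀ {C} → ⊢ipa C → Derivable (C °)
  ⊢ipa⇒derivable (_ , h) =
    cut natZ (All.head (derivation-valid h) (λ _ → zc) (natᶠ zc ∷ []) (λ _ → here refl))

mainTheorem7 : (Sg : Signature) (C : IFm) → Closed C → ⊢ipa C →
    Sys.Derivable Sg (Sys._° Sg C)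
mainTheorem7 Sg C _ = Soundness.⊢ipa⇒derivable Sg
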